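{- Let $f(\mathbf{x},y)\in\mathbb{F}[y][x_1,\dots,x_n]$ be computed by a $\Sigma\wedge\Sigma\wedge$ circuit of size $s$ and degree $d$. Then $\partial_y f$ can be computed by a $\Sigma\wedge\Sigma\wedge$ circuit of size $O(sd^2)$ over $\mathbb{F}[y][\mathbf{x}]$.
   Context: $\mathbb{F}$ is a field of characteristic $0$. A $\Sigma\wedge\Sigma\wedge$ circuit (over the coefficient ring $\mathbb{F}[y]$, in variables $\mathbf{x}$) computes $\sum_i \alpha_i g_i^{e_i}$ with each $g_i$ a sum of univariate polynomials $g_{i1}(x_1)+\cdots+g_{in}(x_n)$; its size accounts for the number of summands, exponents, and sparsities and degrees of the $g_i$. $\partial_y$ is the partial derivative with respect to $y$. -}

module Defs where

open import Level using () renaming (suc to lsuc; _⊔_ to _⊔ˡ_)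
open import Algebra.Bundles using (CommutativeRing)
open import Data.Nat as ℕ using (ℕ; zero; suc; _∸_; _⊔_)
open import Data.Fin using (Fin)
open import Data.Vec using (Vec; replicate; _[_]≔_)
open import Data.Vec.Properties using (≡-dec)
open import Data.List using (List; []; _∷_; _++_; map; foldr; concatMap; allFin)
open import Data.Nat.ListAction using (sum)
open import Data.Product using (Σ; _×_; _,_; ∃)
open import Relation.Nullary using (¬_; yes; no)
open import Relation.Binary.PropositionalEquality using (_≡_)

record Field (c ℓ : Level.Level) : Set (lsuc (c ⊔ˡ ℓ)) where
  field
    commutativeRing : CommutativeRing c ℓ
  open CommutativeRing commutativeRing public
  field
    1≉0     : ¬ (1# ≈ 0#)
    inverse : ∀ x → ¬ (x ≈ 0#) → ∃ λ y → x * y ≈ 1#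

module _ {c ℓ} (F : Field c ℓ) where
  open Field F

  natMul : ℕ → Carrier → Carrier
  natMul zero    a = 0#
  natMul (suc k) a = a + natMul k a

  CharZero : Set ℓ
  CharZero = ∀ (k : ℕ) → natMul k 1# ≈ 0# → k ≡ 0

  -- Polynomials in F[y][x₁,…,xₙ] = F[y,x₁,…,xₙ], as finite formal sums
  -- of terms c · y^k · x^v.  Two formal sums denote the same polynomial
  -- iff all their coefficients agree (_≋_).

  Mon : ℕ → Set
  Mon n = ℕ × Vec ℕ n          -- (exponent of y , exponents of x)

  MPoly : ℕ → Set c
  MPoly n = List (Carrier × Mon n)

  _≟Mon_ : ∀ {n} (m m' : Mon n) → Relation.Nullary.Dec (m ≡ m')
  (k , v) ≟Mon (k' , v') with k ℕ.≟ k' | ≡-dec ℕ._≟_ v v'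
  ... | yes Relation.Binary.PropositionalEquality.refl | yes Relation.Binary.PropositionalEquality.refl = yes Relation.Binary.PropositionalEquality.refl
  ... | no k≢ | _ = no λ { Relation.Binary.PropositionalEquality.refl → k≢ Relation.Binary.PropositionalEquality.refl }
  ... | yes _ | no v≢ = no λ { Relation.Binary.PropositionalEquality.refl → v≢ Relation.Binary.PropositionalEquality.refl }

  coeff : ∀ {n} → MPoly n → Mon n → Carrier
  coeff []             m = 0#
  coeff ((a , m') ∷ p) m with m' ≟Mon m
  ... | yes _ = a + coeff p m
  ... | no  _ = coeff p m

  _≋_ : ∀ {n} → MPoly n → MPoly n → Set ℓ
  p ≋ q = ∀ m → coeff p m ≈ coeff q m

  _⊕_ : ∀ {n} → MPoly n → MPoly n → MPoly n
  p ⊕ q = p ++ q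

  addMon : ∀ {n} → Mon n → Mon n → Mon n
  addMon (k , v) (k' , v') = (k ℕ.+ k' , Data.Vec.zipWith ℕ._+_ v v')

  _⊗_ : ∀ {n} → MPoly n → MPoly n → MPoly n
  p ⊗ q = concatMap (λ { (a , m) → map (λ { (b , m') → (a * b , addMon m m') }) q }) p

  onePoly : ∀ {n} → MPoly n
  onePoly {n} = (1# , (0 , replicate n 0)) ∷ []

  _^^_ : ∀ {n} → MPoly n → ℕ → MPoly n
  p ^^ zero  = onePoly
  p ^^ suc e = p ⊗ (p ^^ e)

  ∂y : ∀ {n} → MPoly n → MPoly n
  ∂y = map (λ { (a , (k , v)) → (natMul k a , (k ∸ 1 , v)) })

  -- elements of F[y]: formal sums of terms c · y^k
  YPoly : Set c
  YPoly = List (Carrier × ℕ)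

  -- univariate polynomials in a variable x_j with coefficients in F[y]:
  -- formal sums of terms a(y) · x_j^k
  XUni : Set c
  XUni = List (YPoly × ℕ)

  -- one summand α · (g₁(x₁) + ⋯ + gₙ(xₙ))^e
  record Summand (n : ℕ) : Set c where
    constructor summand
    field
      α : YPoly
      e : ℕ
      g : Fin n → XUni

  Circuit : ℕ → Set c
  Circuit n = List (Summand n)

  embedY : ∀ {n} → YPoly → MPoly n
  embedY {n} = map (λ { (c' , k) → (c' , (k , replicate n 0)) })

  embedX : ∀ {n} → Fin n → XUni → MPoly n
  embedX {n} j = concatMap (λ { (a , k) →
    map (λ { (c' , l) → (c' , (l , replicate n 0 [ j ]≔ k)) }) a })

  ⟦_⟧g : ∀ {n} → (Fin n → XUni) → MPoly n
  ⟦_⟧g {n} g = concatMap (λ j → embedX j (g j)) (allFin n)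

  ⟦_⟧s : ∀ {n} → Summand n → MPoly n
  ⟦ summand α e g ⟧s = embedY α ⊗ (⟦ g ⟧g ^^ e)

  ⟦_⟧ : ∀ {n} → Circuit n → MPoly n
  ⟦ C ⟧ = concatMap ⟦_⟧s C

  -- size: number of summands, exponents, sparsities and degrees of the
  -- univariates g_ij:  Σ_i (1 + e_i + Σ_j Σ_{terms a(y)x_j^k of g_ij} (1 + k))
  sizeUni : XUni → ℕ
  sizeUni u = sum (map (λ { (_ , k) → suc k }) u)

  sizeS : ∀ {n} → Summand n → ℕ
  sizeS {n} (summand α e g) = suc (e ℕ.+ sum (map (λ j → sizeUni (g j)) (allFin n)))

  size : ∀ {n} → Circuit n → ℕ
  size C = sum (map sizeS C)

  degUni : XUni → ℕ
  degUni u = foldr _⊔_ 0 (map (λ { (_ , k) → k }) u)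

  degS : ∀ {n} → Summand n → ℕ
  degS {n} (summand α e g) = e ℕ.* foldr _⊔_ 0 (map (λ j → degUni (g j)) (allFin n))

  degree : ∀ {n} → Circuit n → ℕ
  degree C = foldr _⊔_ 0 (map degS C)

-- Write a summand as α G^e with G = g₁(x₁) + ⋯ + gₙ(xₙ).  By Leibniz,
-- ∂y (α G^e) = (∂y α) G^e + α · e G^(e-1) ∂y G, and only the product G^(e-1) ∂y G is not
-- already of the required shape.  For N = e - 1 the alternating binomial sum
-- Δ_N h = Σ_{j ≤ N} (-1)^j (N choose j) h(j) annihilates polynomials in j of degree < N
-- and sends j^N to (-1)^N N!; applied to h(j) = (j G + ∂y G)^e it therefore yields
-- e (-1)^N N! G^N ∂y G plus a multiple of G^e.  Each j G + ∂y G is again a sum of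
-- univariates of twice the size, and N! is invertible in characteristic 0, so ∂y (α G^e)
-- is a sum of e + 2 summands of size at most twice that of α G^e, where e ≤ d.  If G does
-- not involve x then e is not bounded by d; such a summand is a constant of F[y], and is
-- replaced by the single constant ∂y (α G^e).

module Submission where

open import Level using (Level)
open import Algebra.Bundles using (CommutativeRing)
open import Algebra.Structures using (IsCommutativeRing)
open import Algebra.Morphism.Structures using (module RingMorphisms)
open RingMorphisms using (IsRingHomomorphism)
open import Data.Empty using (⊥-elim)
open import Data.Fin as Fin using (Fin; toℕ)
open import Data.List using (List; []; _∷_; _++_; map; concatMap; foldr; length; allFin; applyUpTo)
import Data.List.Properties as ListP
open import Data.Nat as ℕ using (ℕ; zero; suc; _<_; _≤_; _∸_; z≤n; s≤s)
import Data.Nat.Properties as ℕP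
import Algebra.Properties.CommutativeSemigroup ℕP.+-commutativeSemigroup as ℕ+
open import Data.Nat.Tactic.RingSolver using (solve-∀)
open import Data.Product using (Σ; ∃; _×_; _,_; proj₁; proj₂)
open import Data.Vec using (Vec; replicate; zipWith; _[_]≔_) renaming (_∷_ to _∷ᵥ_)
import Data.Vec.Properties as VecP
open import Relation.Binary.PropositionalEquality as ≡ using (_≡_; _≢_)
open import Relation.Binary.Structures using (IsEquivalence)
open import Relation.Nullary using (¬_; yes; no)

open import Defs

module FiniteDifference {c ℓ} (S : CommutativeRing c ℓ) where
  open CommutativeRing S
  open import Data.Nat.Combinatorics using (_C_; nCn≡1; nC1≡n; nCk≡nC[n∸k]; k>n⇒nCk≡0; nCk+nC[k+1]≡[n+1]C[k+1])
  import Algebra.Properties.Semiring.Mult semiring as Mult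
  open import Algebra.Properties.Semiring.Exp semiring public using (_^_; ^-congˡ)
  open import Algebra.Properties.CommutativeSemiring.Exp commutativeSemiring using (^-distrib-*)
  open import Algebra.Properties.CommutativeSemigroup +-commutativeSemigroup using (interchange)
  import Algebra.Properties.CommutativeSemiring.Binomial commutativeSemiring as Binomial
  open import Algebra.Properties.Ring ring using (-‿distribˡ-*; -‿+-comm; -0#≈0#)
  open import Algebra.Definitions.RawMonoid +-rawMonoid using (sum)
  open import Relation.Binary.Reasoning.Setoid setoid

  -- Kept opaque so that unification never unfolds sums of lambdas.
  opaque
    sumBelow : ℕ → (ℕ → Carrier) → Carrier
    sumBelow zero    f = 0#
    sumBelow (suc n) f = f 0 + sumBelow n (λ j → f (suc j))

    sumBelow-zero : ∀ f → sumBelow 0 f ≈ 0#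
    sumBelow-zero f = refl

    sumBelow-suc : ∀ n f → sumBelow (suc n) f ≈ f 0 + sumBelow n (λ j → f (suc j))
    sumBelow-suc n f = refl

    sumBelow-cong : ∀ n {f g : ℕ → Carrier} → (∀ j → f j ≈ g j) → sumBelow n f ≈ sumBelow n g
    sumBelow-cong zero    f≈g = refl
    sumBelow-cong (suc n) f≈g = +-cong (f≈g 0) (sumBelow-cong n (λ j → f≈g (suc j)))

    sumBelow-vanishes : ∀ n f → (∀ j → j < n → f j ≈ 0#) → sumBelow n f ≈ 0#
    sumBelow-vanishes zero    f f≈0 = refl
    sumBelow-vanishes (suc n) f f≈0 = begin
      f 0 + sumBelow n (λ j → f (suc j))
        ≈⟨ +-cong (f≈0 0 (s≤s z≤n)) (sumBelow-vanishes n _ (λ j j<n → f≈0 (suc j) (s≤s j<n))) ⟩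
      0# + 0# ≈⟨ +-identityˡ 0# ⟩
      0# ∎

    sumBelow-+ : ∀ n (f g : ℕ → Carrier) → sumBelow n (λ j → f j + g j) ≈ sumBelow n f + sumBelow n g
    sumBelow-+ zero    f g = sym (+-identityˡ 0#)
    sumBelow-+ (suc n) f g =
      trans (+-congˡ (sumBelow-+ n (λ j → f (suc j)) (λ j → g (suc j)))) (interchange _ _ _ _)

    sumBelow-*ˡ : ∀ n x (f : ℕ → Carrier) → x * sumBelow n f ≈ sumBelow n (λ j → x * f j)
    sumBelow-*ˡ zero    x f = zeroʳ x
    sumBelow-*ˡ (suc n) x f = trans (distribˡ x (f 0) _) (+-congˡ (sumBelow-*ˡ n x (λ j → f (suc j))))

    sumBelow-neg : ∀ n (f : ℕ → Carrier) → - sumBelow n f ≈ sumBelow n (λ j → - f j)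
    sumBelow-neg zero    f = -0#≈0#
    sumBelow-neg (suc n) f = trans (sym (-‿+-comm (f 0) _)) (+-congˡ (sumBelow-neg n (λ j → f (suc j))))

    sumBelow-last : ∀ n (f : ℕ → Carrier) → sumBelow (suc n) f ≈ sumBelow n f + f n
    sumBelow-last zero    f = trans (+-identityʳ (f 0)) (sym (+-identityˡ (f 0)))
    sumBelow-last (suc n) f = begin
      f 0 + sumBelow (suc n) (λ j → f (suc j))     ≈⟨ +-congˡ (sumBelow-last n (λ j → f (suc j))) ⟩
      f 0 + (sumBelow n (λ j → f (suc j)) + f (suc n)) ≈⟨ +-assoc _ _ _ ⟨
      (f 0 + sumBelow n (λ j → f (suc j))) + f (suc n) ∎

    sumBelow-swap : ∀ n m (f : ℕ → ℕ → Carrier) →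
      sumBelow n (λ i → sumBelow m (λ j → f i j)) ≈ sumBelow m (λ j → sumBelow n (λ i → f i j))
    sumBelow-swap zero    m f = sym (sumBelow-vanishes m _ (λ _ _ → refl))
    sumBelow-swap (suc n) m f =
      trans (+-congˡ (sumBelow-swap n m (λ i → f (suc i)))) (sym (sumBelow-+ m _ _))

    sum≡sumBelow : ∀ n (f : ℕ → Carrier) → sum {n} (λ i → f (toℕ i)) ≡ sumBelow n f
    sum≡sumBelow zero    f = ≡.refl
    sum≡sumBelow (suc n) f = ≡.cong (f 0 +_) (sum≡sumBelow n (λ j → f (suc j)))

  fromℕ : ℕ → Carrier
  fromℕ k = k Mult.× 1#

  fromℕ-+ : ∀ m n → fromℕ (m ℕ.+ n) ≈ fromℕ m + fromℕ n
  fromℕ-+ m n = Mult.×-homo-+ 1# m n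

  fromℕ-1 : fromℕ 1 ≈ 1#
  fromℕ-1 = +-identityʳ 1#

  fromℕ-cong : ∀ {m n} → m ≡ n → fromℕ m ≈ fromℕ n
  fromℕ-cong ≡.refl = refl

  ×≈fromℕ* : ∀ k x → k Mult.× x ≈ fromℕ k * x
  ×≈fromℕ* k x = begin
    k Mult.× x        ≈⟨ Mult.×-congʳ k (*-identityˡ x) ⟨
    k Mult.× (1# * x) ≈⟨ Mult.×-assoc-* k 1# x ⟨
    fromℕ k * x  ∎

  1#^ : ∀ k → 1# ^ k ≈ 1#
  1#^ zero    = refl
  1#^ (suc k) = trans (*-identityˡ _) (1#^ k)

  binomial : ∀ n x y → (x + y) ^ n ≈ sumBelow (suc n) (λ k → fromℕ (n C k) * (x ^ k * y ^ (n ∸ k)))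
  binomial n x y = begin
    (x + y) ^ n
      ≈⟨ Binomial.theorem n x y ⟩
    sum {suc n} (λ k → (n C toℕ k) Mult.× (x ^ toℕ k * y ^ (n ∸ toℕ k)))
      ≡⟨ sum≡sumBelow (suc n) (λ k → (n C k) Mult.× (x ^ k * y ^ (n ∸ k))) ⟩
    sumBelow (suc n) (λ k → (n C k) Mult.× (x ^ k * y ^ (n ∸ k)))
      ≈⟨ sumBelow-cong (suc n) (λ k → ×≈fromℕ* (n C k) _) ⟩
    sumBelow (suc n) (λ k → fromℕ (n C k) * (x ^ k * y ^ (n ∸ k))) ∎

  sign : ℕ → Carrier
  sign zero    = 1#
  sign (suc j) = - sign j

  -- (-1)^N times the N-th forward difference of f at 0
  Δ : ℕ → (ℕ → Carrier) → Carrier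
  Δ N f = sumBelow (suc N) (λ j → sign j * (fromℕ (N C j) * f j))

  Δ-cong : ∀ N {f g : ℕ → Carrier} → (∀ j → f j ≈ g j) → Δ N f ≈ Δ N g
  Δ-cong N f≈g = sumBelow-cong (suc N) (λ j → *-congˡ (*-congˡ (f≈g j)))

  private
    -x*y≈-[x*y] : ∀ x y → (- x) * y ≈ - (x * y)
    -x*y≈-[x*y] x y = sym (-‿distribˡ-* x y)

    x+[y+z]≈[x+z]+y : ∀ x y z → x + (y + z) ≈ (x + z) + y
    x+[y+z]≈[x+z]+y x y z = trans (+-congˡ (+-comm y z)) (sym (+-assoc x z y))

  -- Pascal's rule, termwise
  Δ-suc-term : ∀ N (f : ℕ → Carrier) j →
    sign (suc j) * (fromℕ (suc N C suc j) * f (suc j))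
      ≈ - (sign j * (fromℕ (N C j) * f (suc j))) + sign (suc j) * (fromℕ (N C suc j) * f (suc j))
  Δ-suc-term N f j = begin
    - sign j * (fromℕ (suc N C suc j) * f (suc j))
      ≈⟨ -x*y≈-[x*y] _ _ ⟩
    - (sign j * (fromℕ (suc N C suc j) * f (suc j)))
      ≈⟨ -‿cong (*-congˡ (*-congʳ (fromℕ-cong (≡.sym (nCk+nC[k+1]≡[n+1]C[k+1] N j))))) ⟩
    - (sign j * (fromℕ (N C j ℕ.+ N C suc j) * f (suc j)))
      ≈⟨ -‿cong (*-congˡ (trans (*-congʳ (fromℕ-+ (N C j) (N C suc j))) (distribʳ _ _ _))) ⟩
    - (sign j * (fromℕ (N C j) * f (suc j) + fromℕ (N C suc j) * f (suc j)))
      ≈⟨ -‿cong (distribˡ _ _ _) ⟩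
    - (sign j * (fromℕ (N C j) * f (suc j)) + sign j * (fromℕ (N C suc j) * f (suc j)))
      ≈⟨ -‿+-comm _ _ ⟨
    - (sign j * (fromℕ (N C j) * f (suc j))) + - (sign j * (fromℕ (N C suc j) * f (suc j)))
      ≈⟨ +-congˡ (-x*y≈-[x*y] _ _) ⟨
    - (sign j * (fromℕ (N C j) * f (suc j))) + sign (suc j) * (fromℕ (N C suc j) * f (suc j)) ∎

  Δ-suc : ∀ N (f : ℕ → Carrier) → Δ (suc N) f ≈ Δ N f + - Δ N (λ j → f (suc j))
  Δ-suc N f = begin
    Δ (suc N) f
      ≈⟨ sumBelow-suc (suc N) _ ⟩
    t₀ + sumBelow (suc N) (λ j → sign (suc j) * (fromℕ (suc N C suc j) * f (suc j)))
      ≈⟨ +-congˡ (sumBelow-cong (suc N) (Δ-suc-term N f)) ⟩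
    t₀ + sumBelow (suc N) (λ j → - (sign j * (fromℕ (N C j) * f (suc j))) + t (suc j))
      ≈⟨ +-congˡ (sumBelow-+ (suc N) (λ j → - (sign j * (fromℕ (N C j) * f (suc j)))) (λ j → t (suc j))) ⟩
    t₀ + (sumBelow (suc N) (λ j → - (sign j * (fromℕ (N C j) * f (suc j)))) + sumBelow (suc N) (λ j → t (suc j)))
      ≈⟨ +-congˡ (+-cong (sym (sumBelow-neg (suc N) (λ j → sign j * (fromℕ (N C j) * f (suc j))))) (sumBelow-last N (λ j → t (suc j)))) ⟩
    t₀ + (- Δ N (λ j → f (suc j)) + (sumBelow N (λ j → t (suc j)) + t (suc N)))
      ≈⟨ +-congˡ (+-congˡ (trans (+-congˡ last-vanishes) (+-identityʳ _))) ⟩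
    t₀ + (- Δ N (λ j → f (suc j)) + sumBelow N (λ j → t (suc j)))
      ≈⟨ x+[y+z]≈[x+z]+y t₀ _ _ ⟩
    (t₀ + sumBelow N (λ j → t (suc j))) + - Δ N (λ j → f (suc j))
      ≈⟨ +-congʳ (sumBelow-suc N t) ⟨
    Δ N f + - Δ N (λ j → f (suc j)) ∎
    where
    t : ℕ → Carrier
    t j = sign j * (fromℕ (N C j) * f j)
    t₀ = sign 0 * (fromℕ (suc N C 0) * f 0)
    last-vanishes : t (suc N) ≈ 0#
    last-vanishes = begin
      sign (suc N) * (fromℕ (N C suc N) * f (suc N))
        ≈⟨ *-congˡ (*-congʳ (fromℕ-cong (k>n⇒nCk≡0 (ℕP.n<1+n N)))) ⟩
      sign (suc N) * (0# * f (suc N)) ≈⟨ trans (*-congˡ (zeroˡ _)) (zeroʳ _) ⟩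
      0# ∎

  Δ-*ʳ : ∀ N (f : ℕ → Carrier) x → Δ N (λ j → f j * x) ≈ Δ N f * x
  Δ-*ʳ N f x = begin
    sumBelow (suc N) (λ j → sign j * (fromℕ (N C j) * (f j * x)))
      ≈⟨ sumBelow-cong (suc N) (λ j → trans (*-congˡ (sym (*-assoc _ _ _))) (trans (sym (*-assoc _ _ _)) (*-comm _ x))) ⟩
    sumBelow (suc N) (λ j → x * (sign j * (fromℕ (N C j) * f j)))
      ≈⟨ sumBelow-*ˡ (suc N) x _ ⟨
    x * Δ N f ≈⟨ *-comm x _ ⟩
    Δ N f * x ∎

  Δ-*ˡ : ∀ N (f : ℕ → Carrier) x → Δ N (λ j → x * f j) ≈ x * Δ N f
  Δ-*ˡ N f x = trans (Δ-cong N (λ j → *-comm x (f j))) (trans (Δ-*ʳ N f x) (*-comm _ x))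

  Δ-sumBelow : ∀ N m (f : ℕ → ℕ → Carrier) → Δ N (λ j → sumBelow m (λ i → f i j)) ≈ sumBelow m (λ i → Δ N (f i))
  Δ-sumBelow N m f = begin
    sumBelow (suc N) (λ j → sign j * (fromℕ (N C j) * sumBelow m (λ i → f i j)))
      ≈⟨ sumBelow-cong (suc N) (λ j → trans (sym (*-assoc _ _ _)) (sumBelow-*ˡ m _ (λ i → f i j))) ⟩
    sumBelow (suc N) (λ j → sumBelow m (λ i → (sign j * fromℕ (N C j)) * f i j))
      ≈⟨ sumBelow-swap (suc N) m _ ⟩
    sumBelow m (λ i → sumBelow (suc N) (λ j → (sign j * fromℕ (N C j)) * f i j))
      ≈⟨ sumBelow-cong m (λ i → sumBelow-cong (suc N) (λ j → *-assoc _ _ _)) ⟩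
    sumBelow m (λ i → Δ N (f i)) ∎

  moment : ℕ → ℕ → Carrier
  moment N k = Δ N (λ j → fromℕ j ^ k)

  fromℕ-suc-^ : ∀ j k → fromℕ (suc j) ^ k ≈ sumBelow (suc k) (λ i → fromℕ (k C i) * fromℕ j ^ i)
  fromℕ-suc-^ j k = begin
    (1# + fromℕ j) ^ k ≈⟨ ^-congˡ k (+-comm 1# (fromℕ j)) ⟩
    (fromℕ j + 1#) ^ k ≈⟨ binomial k (fromℕ j) 1# ⟩
    sumBelow (suc k) (λ i → fromℕ (k C i) * (fromℕ j ^ i * 1# ^ (k ∸ i)))
      ≈⟨ sumBelow-cong (suc k) (λ i → *-congˡ (trans (*-congˡ (1#^ (k ∸ i))) (*-identityʳ _))) ⟩
    sumBelow (suc k) (λ i → fromℕ (k C i) * fromℕ j ^ i) ∎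

  moment-suc : ∀ N k → moment (suc N) k ≈ - sumBelow k (λ i → fromℕ (k C i) * moment N i)
  moment-suc N k = begin
    moment (suc N) k
      ≈⟨ Δ-suc N (λ j → fromℕ j ^ k) ⟩
    moment N k + - Δ N (λ j → fromℕ (suc j) ^ k)
      ≈⟨ +-congˡ (-‿cong (Δ-cong N (λ j → fromℕ-suc-^ j k))) ⟩
    moment N k + - Δ N (λ j → sumBelow (suc k) (λ i → fromℕ (k C i) * fromℕ j ^ i))
      ≈⟨ +-congˡ (-‿cong (Δ-sumBelow N (suc k) (λ i j → fromℕ (k C i) * fromℕ j ^ i))) ⟩
    moment N k + - sumBelow (suc k) (λ i → Δ N (λ j → fromℕ (k C i) * fromℕ j ^ i))
      ≈⟨ +-congˡ (-‿cong (sumBelow-cong (suc k) (λ i → Δ-*ˡ N (λ j → fromℕ j ^ i) _))) ⟩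
    moment N k + - sumBelow (suc k) t
      ≈⟨ +-congˡ (-‿cong (sumBelow-last k t)) ⟩
    moment N k + - (sumBelow k t + t k)
      ≈⟨ +-congˡ (-‿cong (+-congˡ (trans (*-congʳ (trans (fromℕ-cong (nCn≡1 k)) fromℕ-1)) (*-identityˡ _)))) ⟩
    moment N k + - (sumBelow k t + moment N k)
      ≈⟨ +-congˡ (-‿+-comm _ _) ⟨
    moment N k + (- sumBelow k t + - moment N k)
      ≈⟨ x+[y+z]≈[x+z]+y _ _ _ ⟩
    (moment N k + - moment N k) + - sumBelow k t
      ≈⟨ trans (+-congʳ (-‿inverseʳ _)) (+-identityˡ _) ⟩
    - sumBelow k t ∎
    where
    t : ℕ → Carrier
    t i = fromℕ (k C i) * moment N i

  signedFactorial : ℕ → Carrier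
  signedFactorial zero    = 1#
  signedFactorial (suc N) = - (fromℕ (suc N) * signedFactorial N)

  private
    suc-C-pred : ∀ N → suc N C N ≡ suc N
    suc-C-pred N = ≡.trans (nCk≡nC[n∸k] (ℕP.n≤1+n N)) (≡.trans (≡.cong (suc N C_) (ℕP.m+n∸n≡m 1 N)) (nC1≡n (suc N)))

  moment-below∧diagonal : ∀ N → (∀ k → k < N → moment N k ≈ 0#) × (moment N N ≈ signedFactorial N)
  moment-below∧diagonal zero = (λ _ ()) , (begin
    moment 0 0             ≈⟨ sumBelow-suc 0 _ ⟩
    sign 0 * (fromℕ 1 * 1#) + sumBelow 0 _
      ≈⟨ +-cong (trans (*-identityˡ _) (trans (*-congʳ fromℕ-1) (*-identityˡ _))) (sumBelow-zero _) ⟩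
    1# + 0#               ≈⟨ +-identityʳ 1# ⟩
    1#                    ∎)
  moment-below∧diagonal (suc N) = below , diagonal
    where
    below-N = proj₁ (moment-below∧diagonal N)
    t : ℕ → ℕ → Carrier
    t k i = fromℕ (k C i) * moment N i
    t-vanishes : ∀ k i → i < N → t k i ≈ 0#
    t-vanishes k i i<N = trans (*-congˡ (below-N i i<N)) (zeroʳ _)
    below : ∀ k → k < suc N → moment (suc N) k ≈ 0#
    below k (s≤s k≤N) = begin
      moment (suc N) k       ≈⟨ moment-suc N k ⟩
      - sumBelow k (t k)     ≈⟨ -‿cong (sumBelow-vanishes k _ (λ i i<k → t-vanishes k i (ℕP.<-≤-trans i<k k≤N))) ⟩
      - 0#                   ≈⟨ -0#≈0# ⟩
      0#                     ∎
    diagonal : moment (suc N) (suc N) ≈ signedFactorial (suc N)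
    diagonal = begin
      moment (suc N) (suc N)                     ≈⟨ moment-suc N (suc N) ⟩
      - sumBelow (suc N) (t (suc N))             ≈⟨ -‿cong (sumBelow-last N _) ⟩
      - (sumBelow N (t (suc N)) + t (suc N) N)   ≈⟨ -‿cong (+-congʳ (sumBelow-vanishes N _ (t-vanishes (suc N)))) ⟩
      - (0# + t (suc N) N)                       ≈⟨ -‿cong (+-identityˡ _) ⟩
      - (fromℕ (suc N C N) * moment N N)         ≈⟨ -‿cong (*-cong (fromℕ-cong (suc-C-pred N)) (proj₂ (moment-below∧diagonal N))) ⟩
      - (fromℕ (suc N) * signedFactorial N)      ∎

  moment-below : ∀ N k → k < N → moment N k ≈ 0#
  moment-below N = proj₁ (moment-below∧diagonal N)

  moment-diagonal : ∀ N → moment N N ≈ signedFactorial N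
  moment-diagonal N = proj₂ (moment-below∧diagonal N)

  -- Only the terms k = N and k = N + 1 of the binomial expansion in j survive Δ N.
  Δ-affine-power : ∀ N A B → Δ N (λ j → (fromℕ j * A + B) ^ suc N)
                   ≈ (fromℕ (suc N) * signedFactorial N) * (A ^ N * B) + moment N (suc N) * A ^ suc N
  Δ-affine-power N A B = begin
    Δ N (λ j → (fromℕ j * A + B) ^ e)
      ≈⟨ Δ-cong N (λ j → trans (binomial e (fromℕ j * A) B) (sumBelow-cong (suc e) (separate j))) ⟩
    Δ N (λ j → sumBelow (suc e) (λ k → fromℕ j ^ k * t k))
      ≈⟨ Δ-sumBelow N (suc e) (λ k j → fromℕ j ^ k * t k) ⟩
    sumBelow (suc e) (λ k → Δ N (λ j → fromℕ j ^ k * t k))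
      ≈⟨ sumBelow-cong (suc e) (λ k → Δ-*ʳ N (λ j → fromℕ j ^ k) (t k)) ⟩
    sumBelow (suc e) u ≈⟨ trans (sumBelow-last e u) (+-congʳ (sumBelow-last N u)) ⟩
    (sumBelow N u + u N) + u e
      ≈⟨ +-congʳ (+-congʳ (sumBelow-vanishes N u (λ k k<N → trans (*-congʳ (moment-below N k k<N)) (zeroˡ _)))) ⟩
    (0# + u N) + u e ≈⟨ +-cong (+-identityˡ _) (*-congˡ t-top) ⟩
    u N + moment N e * A ^ e ≈⟨ +-congʳ u-N ⟩
    (fromℕ e * signedFactorial N) * (A ^ N * B) + moment N e * A ^ e ∎
    where
    e = suc N
    t : ℕ → Carrier
    t k = fromℕ (e C k) * (A ^ k * B ^ (e ∸ k))
    u : ℕ → Carrier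
    u k = moment N k * t k
    separate : ∀ j k → fromℕ (e C k) * ((fromℕ j * A) ^ k * B ^ (e ∸ k)) ≈ fromℕ j ^ k * t k
    separate j k = begin
      fromℕ (e C k) * ((fromℕ j * A) ^ k * B ^ (e ∸ k))   ≈⟨ *-congˡ (*-congʳ (^-distrib-* (fromℕ j) A k)) ⟩
      fromℕ (e C k) * ((fromℕ j ^ k * A ^ k) * B ^ (e ∸ k)) ≈⟨ *-congˡ (*-assoc _ _ _) ⟩
      fromℕ (e C k) * (fromℕ j ^ k * (A ^ k * B ^ (e ∸ k))) ≈⟨ *-assoc _ _ _ ⟨
      (fromℕ (e C k) * fromℕ j ^ k) * (A ^ k * B ^ (e ∸ k)) ≈⟨ *-congʳ (*-comm _ _) ⟩
      (fromℕ j ^ k * fromℕ (e C k)) * (A ^ k * B ^ (e ∸ k)) ≈⟨ *-assoc _ _ _ ⟩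
      fromℕ j ^ k * t k ∎
    t-top : t e ≈ A ^ e
    t-top = begin
      fromℕ (e C e) * (A ^ e * B ^ (e ∸ e))
        ≈⟨ *-cong (trans (fromℕ-cong (nCn≡1 e)) fromℕ-1) (*-congˡ (reflexive (≡.cong (B ^_) (ℕP.n∸n≡0 e)))) ⟩
      1# * (A ^ e * 1#) ≈⟨ trans (*-identityˡ _) (*-identityʳ _) ⟩
      A ^ e ∎
    u-N : u N ≈ (fromℕ e * signedFactorial N) * (A ^ N * B)
    u-N = begin
      moment N N * (fromℕ (e C N) * (A ^ N * B ^ (e ∸ N)))
        ≈⟨ *-cong (moment-diagonal N) (*-cong (fromℕ-cong (suc-C-pred N)) (*-congˡ (reflexive (≡.cong (B ^_) (ℕP.m+n∸n≡m 1 N))))) ⟩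
      signedFactorial N * (fromℕ e * (A ^ N * (B * 1#))) ≈⟨ *-congˡ (*-congˡ (*-congˡ (*-identityʳ B))) ⟩
      signedFactorial N * (fromℕ e * (A ^ N * B))         ≈⟨ *-assoc _ _ _ ⟨
      (signedFactorial N * fromℕ e) * (A ^ N * B)         ≈⟨ *-congʳ (*-comm _ _) ⟩
      (fromℕ e * signedFactorial N) * (A ^ N * B)         ∎

  power-derivative-interpolation : ∀ N (A G G' u : Carrier) → u * signedFactorial N ≈ 1# →
    ((- (u * moment N (suc N))) * A) * G ^ suc N
      + sumBelow (suc N) (λ j → ((u * (sign j * fromℕ (N C j))) * A) * (fromℕ j * G + G') ^ suc N)
    ≈ A * (fromℕ (suc N) * (G ^ N * G'))
  power-derivative-interpolation N A G G' u u*s≈1 = begin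
    ((- (u * moment N e)) * A) * G ^ e + sumBelow (suc N) (λ j → ((u * (sign j * fromℕ (N C j))) * A) * Q j)
      ≈⟨ +-cong G^e-term (sumBelow-cong (suc N) Q-term) ⟩
    - W + sumBelow (suc N) (λ j → Y * (sign j * (fromℕ (N C j) * Q j)))
      ≈⟨ +-congˡ (sumBelow-*ˡ (suc N) Y _) ⟨
    - W + Y * Δ N Q
      ≈⟨ +-congˡ (trans (*-congˡ (Δ-affine-power N G G')) (distribˡ _ _ _)) ⟩
    - W + (V + W)   ≈⟨ trans (+-congˡ (+-comm V W)) (sym (+-assoc _ _ _)) ⟩
    (- W + W) + V   ≈⟨ trans (+-congʳ (-‿inverseˡ W)) (+-identityˡ V) ⟩
    V               ≈⟨ V≈ ⟩
    A * (fromℕ e * X) ∎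
    where
    e = suc N
    X = G ^ N * G'
    Q : ℕ → Carrier
    Q j = (fromℕ j * G + G') ^ e
    Y = u * A
    W = Y * (moment N e * G ^ e)
    V = Y * ((fromℕ e * signedFactorial N) * X)
    [u*c]*A≈[u*A]*c : ∀ c → (u * c) * A ≈ Y * c
    [u*c]*A≈[u*A]*c c = trans (*-assoc u c A) (trans (*-congˡ (*-comm c A)) (sym (*-assoc u A c)))
    G^e-term : ((- (u * moment N e)) * A) * G ^ e ≈ - W
    G^e-term = begin
      ((- (u * moment N e)) * A) * G ^ e ≈⟨ *-congʳ (-x*y≈-[x*y] _ _) ⟩
      (- ((u * moment N e) * A)) * G ^ e ≈⟨ -x*y≈-[x*y] _ _ ⟩
      - (((u * moment N e) * A) * G ^ e) ≈⟨ -‿cong (trans (*-congʳ ([u*c]*A≈[u*A]*c _)) (*-assoc _ _ _)) ⟩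
      - W ∎
    Q-term : ∀ j → ((u * (sign j * fromℕ (N C j))) * A) * Q j ≈ Y * (sign j * (fromℕ (N C j) * Q j))
    Q-term j = begin
      ((u * (sign j * fromℕ (N C j))) * A) * Q j ≈⟨ *-congʳ ([u*c]*A≈[u*A]*c _) ⟩
      (Y * (sign j * fromℕ (N C j))) * Q j     ≈⟨ *-assoc _ _ _ ⟩
      Y * ((sign j * fromℕ (N C j)) * Q j)     ≈⟨ *-congˡ (*-assoc _ _ _) ⟩
      Y * (sign j * (fromℕ (N C j) * Q j))     ∎
    V≈ : V ≈ A * (fromℕ e * X)
    V≈ = begin
      (u * A) * ((fromℕ e * signedFactorial N) * X)   ≈⟨ *-congʳ (*-comm u A) ⟩
      (A * u) * ((fromℕ e * signedFactorial N) * X)   ≈⟨ *-assoc _ _ _ ⟩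
      A * (u * ((fromℕ e * signedFactorial N) * X))   ≈⟨ *-congˡ (*-congˡ (trans (*-congʳ (*-comm _ _)) (*-assoc _ _ _))) ⟩
      A * (u * (signedFactorial N * (fromℕ e * X)))   ≈⟨ *-congˡ (*-assoc _ _ _) ⟨
      A * ((u * signedFactorial N) * (fromℕ e * X))   ≈⟨ *-congˡ (trans (*-congʳ u*s≈1) (*-identityˡ _)) ⟩
      A * (fromℕ e * X)                               ∎

  derivation-^ : (d : Carrier → Carrier) → (∀ x y → d (x * y) ≈ d x * y + x * d y) → d 1# ≈ 0# →
                 ∀ N x → d (x ^ suc N) ≈ fromℕ (suc N) * (x ^ N * d x)
  derivation-^ d leibniz d1≈0 zero x = begin
    d (x * 1#)                ≈⟨ leibniz x 1# ⟩
    d x * 1# + x * d 1#       ≈⟨ +-cong (*-identityʳ _) (trans (*-congˡ d1≈0) (zeroʳ x)) ⟩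
    d x + 0#                  ≈⟨ +-identityʳ _ ⟩
    d x                       ≈⟨ trans (*-identityˡ _) (*-identityˡ _) ⟨
    1# * (1# * d x)           ≈⟨ *-congʳ fromℕ-1 ⟨
    fromℕ 1 * (1# * d x)      ∎
  derivation-^ d leibniz d1≈0 (suc N) x = begin
    d (x * x ^ suc N)                                          ≈⟨ leibniz x _ ⟩
    d x * (x * x ^ N) + x * d (x ^ suc N)                      ≈⟨ +-congˡ (*-congˡ (derivation-^ d leibniz d1≈0 N x)) ⟩
    d x * (x * x ^ N) + x * (fromℕ (suc N) * (x ^ N * d x))   ≈⟨ +-cong (*-comm _ _) (x*[c*[y*z]]≈c*[[x*y]*z] x (fromℕ (suc N)) _ _) ⟩
    (x * x ^ N) * d x + fromℕ (suc N) * ((x * x ^ N) * d x)   ≈⟨ +-congʳ (*-identityˡ _) ⟨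
    1# * ((x * x ^ N) * d x) + fromℕ (suc N) * ((x * x ^ N) * d x) ≈⟨ distribʳ _ _ _ ⟨
    fromℕ (suc (suc N)) * ((x * x ^ N) * d x)                   ∎
    where
    x*[c*[y*z]]≈c*[[x*y]*z] : ∀ x c y z → x * (c * (y * z)) ≈ c * ((x * y) * z)
    x*[c*[y*z]]≈c*[[x*y]*z] x c y z = begin
      x * (c * (y * z)) ≈⟨ *-assoc x c _ ⟨
      (x * c) * (y * z) ≈⟨ *-congʳ (*-comm x c) ⟩
      (c * x) * (y * z) ≈⟨ *-assoc c x _ ⟩
      c * (x * (y * z)) ≈⟨ *-congˡ (*-assoc x y z) ⟨
      c * ((x * y) * z) ∎

module FiniteDifference-homomorphism
  {c₁ ℓ₁ c₂ ℓ₂} (R : CommutativeRing c₁ ℓ₁) (S : CommutativeRing c₂ ℓ₂)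
  {φ : CommutativeRing.Carrier R → CommutativeRing.Carrier S}
  (φ-isRingHomomorphism : IsRingHomomorphism (CommutativeRing.rawRing R) (CommutativeRing.rawRing S) φ)
  where
  private
    module ΔR = FiniteDifference R
    module ΔS = FiniteDifference S
  open CommutativeRing S
  open import Data.Nat.Combinatorics using (_C_)
  open IsRingHomomorphism φ-isRingHomomorphism
  open import Relation.Binary.Reasoning.Setoid setoid

  sumBelow-homo : ∀ n f → φ (ΔR.sumBelow n f) ≈ ΔS.sumBelow n (λ j → φ (f j))
  sumBelow-homo zero f = begin
    φ (ΔR.sumBelow 0 f)        ≈⟨ ⟦⟧-cong (ΔR.sumBelow-zero f) ⟩
    φ (CommutativeRing.0# R)   ≈⟨ 0#-homo ⟩
    0#                         ≈⟨ ΔS.sumBelow-zero _ ⟨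
    ΔS.sumBelow 0 (λ j → φ (f j)) ∎
  sumBelow-homo (suc n) f = begin
    φ (ΔR.sumBelow (suc n) f)                                      ≈⟨ ⟦⟧-cong (ΔR.sumBelow-suc n f) ⟩
    φ (CommutativeRing._+_ R (f 0) (ΔR.sumBelow n (λ j → f (suc j)))) ≈⟨ +-homo _ _ ⟩
    φ (f 0) + φ (ΔR.sumBelow n (λ j → f (suc j)))                  ≈⟨ +-congˡ (sumBelow-homo n (λ j → f (suc j))) ⟩
    φ (f 0) + ΔS.sumBelow n (λ j → φ (f (suc j)))                  ≈⟨ ΔS.sumBelow-suc n (λ j → φ (f j)) ⟨
    ΔS.sumBelow (suc n) (λ j → φ (f j))                            ∎

  fromℕ-homo : ∀ k → φ (ΔR.fromℕ k) ≈ ΔS.fromℕ k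
  fromℕ-homo zero    = 0#-homo
  fromℕ-homo (suc k) = trans (+-homo _ _) (+-cong 1#-homo (fromℕ-homo k))

  ^-homo : ∀ x k → φ (x ΔR.^ k) ≈ φ x ΔS.^ k
  ^-homo x zero    = 1#-homo
  ^-homo x (suc k) = trans (*-homo _ _) (*-congˡ (^-homo x k))

  sign-homo : ∀ j → φ (ΔR.sign j) ≈ ΔS.sign j
  sign-homo zero    = 1#-homo
  sign-homo (suc j) = trans (-‿homo _) (-‿cong (sign-homo j))

  Δ-homo : ∀ N f → φ (ΔR.Δ N f) ≈ ΔS.Δ N (λ j → φ (f j))
  Δ-homo N f = trans (sumBelow-homo (suc N) _) (ΔS.sumBelow-cong (suc N) (λ j →
    trans (*-homo _ _) (*-cong (sign-homo j) (trans (*-homo _ _) (*-congʳ (fromℕ-homo (N C j)))))))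

  moment-homo : ∀ N k → φ (ΔR.moment N k) ≈ ΔS.moment N k
  moment-homo N k = trans (Δ-homo N _) (ΔS.Δ-cong N (λ j → trans (^-homo _ k) (ΔS.^-congˡ k (fromℕ-homo j))))

  signedFactorial-homo : ∀ N → φ (ΔR.signedFactorial N) ≈ ΔS.signedFactorial N
  signedFactorial-homo zero    = 1#-homo
  signedFactorial-homo (suc N) =
    trans (-‿homo _) (-‿cong (trans (*-homo _ _) (*-cong (fromℕ-homo (suc N)) (signedFactorial-homo N))))

module PolynomialRing {c ℓ} (F : Field c ℓ) (n : ℕ) where
  open Field F
  open import Algebra.Properties.Ring ring using (-‿distribˡ-*; -‿+-comm; -0#≈0#)
  open import Algebra.Properties.CommutativeSemigroup +-commutativeSemigroup using (interchange)
  open import Relation.Binary.Reasoning.Setoid setoid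

  Poly : Set c
  Poly = MPoly F n

  Mono : Set
  Mono = Mon F n

  private variable
    a b : Level
    A : Set a
    B : Set b

  sumOver : List A → (A → Carrier) → Carrier
  sumOver []       f = 0#
  sumOver (x ∷ xs) f = f x + sumOver xs f

  sumOver-cong : ∀ (xs : List A) {f g : A → Carrier} → (∀ x → f x ≈ g x) → sumOver xs f ≈ sumOver xs g
  sumOver-cong []       f≈g = refl
  sumOver-cong (x ∷ xs) f≈g = +-cong (f≈g x) (sumOver-cong xs f≈g)

  sumOver-+ : ∀ (xs : List A) f g → sumOver xs (λ x → f x + g x) ≈ sumOver xs f + sumOver xs g
  sumOver-+ []       f g = sym (+-identityˡ 0#)
  sumOver-+ (x ∷ xs) f g = trans (+-congˡ (sumOver-+ xs f g)) (interchange _ _ _ _)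

  sumOver-0# : ∀ (xs : List A) → sumOver xs (λ _ → 0#) ≈ 0#
  sumOver-0# []       = refl
  sumOver-0# (x ∷ xs) = trans (+-identityˡ _) (sumOver-0# xs)

  sumOver-*ˡ : ∀ (xs : List A) k f → k * sumOver xs f ≈ sumOver xs (λ x → k * f x)
  sumOver-*ˡ []       k f = zeroʳ k
  sumOver-*ˡ (x ∷ xs) k f = trans (distribˡ k _ _) (+-congˡ (sumOver-*ˡ xs k f))

  sumOver-neg : ∀ (xs : List A) f → - sumOver xs f ≈ sumOver xs (λ x → - f x)
  sumOver-neg []       f = -0#≈0#
  sumOver-neg (x ∷ xs) f = trans (sym (-‿+-comm _ _)) (+-congˡ (sumOver-neg xs f))

  sumOver-++ : ∀ (xs ys : List A) f → sumOver (xs ++ ys) f ≈ sumOver xs f + sumOver ys f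
  sumOver-++ []       ys f = sym (+-identityˡ _)
  sumOver-++ (x ∷ xs) ys f = trans (+-congˡ (sumOver-++ xs ys f)) (sym (+-assoc _ _ _))

  sumOver-map : ∀ (g : A → B) (xs : List A) f → sumOver (map g xs) f ≡ sumOver xs (λ x → f (g x))
  sumOver-map g []       f = ≡.refl
  sumOver-map g (x ∷ xs) f = ≡.cong (f (g x) +_) (sumOver-map g xs f)

  sumOver-concatMap : ∀ (g : A → List B) (xs : List A) f →
    sumOver (concatMap g xs) f ≈ sumOver xs (λ x → sumOver (g x) f)
  sumOver-concatMap g []       f = refl
  sumOver-concatMap g (x ∷ xs) f = trans (sumOver-++ (g x) (concatMap g xs) f) (+-congˡ (sumOver-concatMap g xs f))

  sumOver-swap : ∀ (xs : List A) (ys : List B) (f : A → B → Carrier) →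
    sumOver xs (λ x → sumOver ys (λ y → f x y)) ≈ sumOver ys (λ y → sumOver xs (λ x → f x y))
  sumOver-swap []       ys f = sym (sumOver-0# ys)
  sumOver-swap (x ∷ xs) ys f = trans (+-congˡ (sumOver-swap xs ys f)) (sym (sumOver-+ ys _ _))

  δ : Mono → Mono → Carrier
  δ m′ m with _≟Mon_ F m′ m
  ... | yes _ = 1#
  ... | no  _ = 0#

  pairing : Poly → (Mono → Carrier) → Carrier
  pairing p h = sumOver p (λ t → proj₁ t * h (proj₂ t))

  coeffSum : Poly → Mono → Carrier
  coeffSum p m = pairing p (λ m′ → δ m′ m)

  coeff≈coeffSum : ∀ p m → coeff F p m ≈ coeffSum p m
  coeff≈coeffSum []              m = refl
  coeff≈coeffSum ((a , m′) ∷ p) m with _≟Mon_ F m′ m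
  ... | yes _ = +-cong (sym (*-identityʳ a)) (coeff≈coeffSum p m)
  ... | no  _ = trans (sym (+-identityˡ _)) (+-cong (sym (zeroʳ a)) (coeff≈coeffSum p m))

  coeffSum⇒≋ : ∀ p q → (∀ m → coeffSum p m ≈ coeffSum q m) → _≋_ F p q
  coeffSum⇒≋ p q eq m = trans (coeff≈coeffSum p m) (trans (eq m) (sym (coeff≈coeffSum q m)))

  ≋⇒coeffSum : ∀ p q → _≋_ F p q → ∀ m → coeffSum p m ≈ coeffSum q m
  ≋⇒coeffSum p q p≋q m = trans (sym (coeff≈coeffSum p m)) (trans (p≋q m) (coeff≈coeffSum q m))

  remove : Mono → Poly → Poly
  remove m []              = []
  remove m ((a , m′) ∷ p) with _≟Mon_ F m′ m
  ... | yes _ = remove m p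
  ... | no  _ = (a , m′) ∷ remove m p

  length-remove : ∀ m p → length (remove m p) ≤ length p
  length-remove m []              = z≤n
  length-remove m ((a , m′) ∷ p) with _≟Mon_ F m′ m
  ... | yes _ = ℕP.m≤n⇒m≤1+n (length-remove m p)
  ... | no  _ = s≤s (length-remove m p)

  length-remove-head : ∀ a m p → length (remove m ((a , m) ∷ p)) ≤ length p
  length-remove-head a m p with _≟Mon_ F m m
  ... | yes _ = length-remove m p
  ... | no m≢m = ⊥-elim (m≢m ≡.refl)

  coeff-remove-self : ∀ m p → coeff F (remove m p) m ≈ 0#
  coeff-remove-self m []              = refl
  coeff-remove-self m ((a , m′) ∷ p) with _≟Mon_ F m′ m
  ... | yes _ = coeff-remove-self m p
  ... | no m′≢m with _≟Mon_ F m′ m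
  ...   | yes m′≡m = ⊥-elim (m′≢m m′≡m)
  ...   | no  _    = coeff-remove-self m p

  coeff-remove-other : ∀ m m′ p → m′ ≢ m → coeff F (remove m p) m′ ≈ coeff F p m′
  coeff-remove-other m m′ []               m′≢m = refl
  coeff-remove-other m m′ ((a , m″) ∷ p) m′≢m with _≟Mon_ F m″ m
  ... | yes ≡.refl with _≟Mon_ F m″ m′
  ...   | yes m≡m′ = ⊥-elim (m′≢m (≡.sym m≡m′))
  ...   | no  _    = coeff-remove-other m m′ p m′≢m
  coeff-remove-other m m′ ((a , m″) ∷ p) m′≢m | no _ with _≟Mon_ F m″ m′
  ...   | yes _ = +-congˡ (coeff-remove-other m m′ p m′≢m)
  ...   | no  _ = coeff-remove-other m m′ p m′≢m

  remove-≋ : ∀ m {p q} → _≋_ F p q → _≋_ F (remove m p) (remove m q)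
  remove-≋ m {p} {q} p≋q m′ with _≟Mon_ F m′ m
  ... | yes ≡.refl = trans (coeff-remove-self m p) (sym (coeff-remove-self m q))
  ... | no m′≢m    = trans (coeff-remove-other m m′ p m′≢m) (trans (p≋q m′) (sym (coeff-remove-other m m′ q m′≢m)))

  pairing-remove : ∀ m p h → pairing p h ≈ coeff F p m * h m + pairing (remove m p) h
  pairing-remove m []              h = sym (trans (+-identityʳ _) (zeroˡ _))
  pairing-remove m ((a , m′) ∷ p) h with _≟Mon_ F m′ m
  ... | yes ≡.refl = begin
    a * h m′ + pairing p h                                              ≈⟨ +-congˡ (pairing-remove m′ p h) ⟩
    a * h m′ + (coeff F p m′ * h m′ + pairing (remove m′ p) h)           ≈⟨ +-assoc _ _ _ ⟨
    (a * h m′ + coeff F p m′ * h m′) + pairing (remove m′ p) h           ≈⟨ +-congʳ (distribʳ _ _ _) ⟨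
    (a + coeff F p m′) * h m′ + pairing (remove m′ p) h                  ∎
  ... | no _ = begin
    a * h m′ + pairing p h                                              ≈⟨ +-congˡ (pairing-remove m p h) ⟩
    a * h m′ + (coeff F p m * h m + pairing (remove m p) h)              ≈⟨ +-assoc _ _ _ ⟨
    (a * h m′ + coeff F p m * h m) + pairing (remove m p) h              ≈⟨ +-congʳ (+-comm _ _) ⟩
    (coeff F p m * h m + a * h m′) + pairing (remove m p) h              ≈⟨ +-assoc _ _ _ ⟩
    coeff F p m * h m + (a * h m′ + pairing (remove m p) h)              ∎

  -- Induction on the total length: both sides lose all terms in the head monomial.
  pairing-cong-bounded : ∀ k p q h → length p ℕ.+ length q ≤ k → _≋_ F p q → pairing p h ≈ pairing q h
  pairing-cong-bounded k       []             []             h _ _ = refl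
  pairing-cong-bounded (suc k) p@((a , m) ∷ p′) q            h (s≤s len) p≋q = begin
    pairing p h                                           ≈⟨ pairing-remove m p h ⟩
    coeff F p m * h m + pairing (remove m p) h
      ≈⟨ +-cong (*-congʳ (p≋q m)) (pairing-cong-bounded k (remove m p) (remove m q) h
           (ℕP.≤-trans (ℕP.+-mono-≤ (length-remove-head a m p′) (length-remove m q)) len) (remove-≋ m {p} {q} p≋q)) ⟩
    coeff F q m * h m + pairing (remove m q) h            ≈⟨ pairing-remove m q h ⟨
    pairing q h                                           ∎
  pairing-cong-bounded (suc k) []             q@((b , m) ∷ q′) h (s≤s len) p≋q = begin
    pairing [] h                                          ≈⟨ pairing-remove m [] h ⟩
    coeff F [] m * h m + pairing [] h
      ≈⟨ +-cong (*-congʳ (p≋q m)) (pairing-cong-bounded k [] (remove m q) h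
           (ℕP.≤-trans (length-remove-head b m q′) len) (remove-≋ m {[]} {q} p≋q)) ⟩
    coeff F q m * h m + pairing (remove m q) h            ≈⟨ pairing-remove m q h ⟨
    pairing q h                                           ∎

  pairing-cong : ∀ p q h → _≋_ F p q → pairing p h ≈ pairing q h
  pairing-cong p q h = pairing-cong-bounded _ p q h ℕP.≤-refl

  _≈ₚ_ : Poly → Poly → Set ℓ
  _≈ₚ_ = _≋_ F

  _+ₚ_ _*ₚ_ : Poly → Poly → Poly
  _+ₚ_ = _⊕_ F
  _*ₚ_ = _⊗_ F

  -ₚ_ : Poly → Poly
  -ₚ_ = map (λ t → (- proj₁ t , proj₂ t))

  0ₚ 1ₚ : Poly
  0ₚ = []
  1ₚ = onePoly F

  0ₘ : Mono
  0ₘ = (0 , replicate n 0)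

  addMon-comm : ∀ (m₁ m₂ : Mono) → addMon F m₁ m₂ ≡ addMon F m₂ m₁
  addMon-comm (k , v) (k′ , v′) = ≡.cong₂ _,_ (ℕP.+-comm k k′) (VecP.zipWith-comm ℕP.+-comm v v′)

  addMon-assoc : ∀ (m₁ m₂ m₃ : Mono) → addMon F (addMon F m₁ m₂) m₃ ≡ addMon F m₁ (addMon F m₂ m₃)
  addMon-assoc (k , v) (k′ , v′) (k″ , v″) = ≡.cong₂ _,_ (ℕP.+-assoc k k′ k″) (VecP.zipWith-assoc ℕP.+-assoc v v′ v″)

  addMon-identityˡ : ∀ (m : Mono) → addMon F 0ₘ m ≡ m
  addMon-identityˡ (k , v) = ≡.cong (k ,_) (VecP.zipWith-identityˡ ℕP.+-identityˡ v)

  sumOver-⊗ : ∀ p q (f : Carrier × Mono → Carrier) →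
    sumOver (p *ₚ q) f ≈ sumOver p (λ t → sumOver q (λ u → f (proj₁ t * proj₁ u , addMon F (proj₂ t) (proj₂ u))))
  sumOver-⊗ p q f = trans (sumOver-concatMap _ p f) (sumOver-cong p (λ t → reflexive (sumOver-map _ q f)))

  coeffSum-⊗ : ∀ p q m →
    coeffSum (p *ₚ q) m ≈ sumOver p (λ t → sumOver q (λ u → (proj₁ t * proj₁ u) * δ (addMon F (proj₂ t) (proj₂ u)) m))
  coeffSum-⊗ p q m = sumOver-⊗ p q (λ t → proj₁ t * δ (proj₂ t) m)

  -- The coefficients of p * q are linear in p; this is what makes _*ₚ_ respect _≈ₚ_.
  coeffSum-⊗-pairing : ∀ p q m → coeffSum (p *ₚ q) m ≈ pairing p (λ m₁ → sumOver q (λ u → proj₁ u * δ (addMon F m₁ (proj₂ u)) m))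
  coeffSum-⊗-pairing p q m =
    trans (coeffSum-⊗ p q m) (sumOver-cong p (λ t → trans (sumOver-cong q (λ u → *-assoc _ _ _)) (sym (sumOver-*ˡ q (proj₁ t) _))))

  coeffSum-++ : ∀ p q m → coeffSum (p +ₚ q) m ≈ coeffSum p m + coeffSum q m
  coeffSum-++ p q m = sumOver-++ p q _

  coeffSum-neg : ∀ p m → coeffSum (-ₚ p) m ≈ - coeffSum p m
  coeffSum-neg p m =
    trans (reflexive (sumOver-map _ p _)) (trans (sumOver-cong p (λ t → sym (-‿distribˡ-* _ _))) (sym (sumOver-neg p _)))

  ≈ₚ-isEquivalence : IsEquivalence _≈ₚ_
  ≈ₚ-isEquivalence = record
    { refl  = λ m → refl
    ; sym   = λ p≈q m → sym (p≈q m)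
    ; trans = λ p≈q q≈r m → trans (p≈q m) (q≈r m)
    }

  +ₚ-cong : ∀ {p p′ q q′} → p ≈ₚ p′ → q ≈ₚ q′ → (p +ₚ q) ≈ₚ (p′ +ₚ q′)
  +ₚ-cong {p} {p′} {q} {q′} p≈p′ q≈q′ = coeffSum⇒≋ (p +ₚ q) (p′ +ₚ q′) λ m →
    trans (coeffSum-++ p q m) (trans (+-cong (≋⇒coeffSum p p′ p≈p′ m) (≋⇒coeffSum q q′ q≈q′ m)) (sym (coeffSum-++ p′ q′ m)))

  +ₚ-assoc : ∀ p q r → ((p +ₚ q) +ₚ r) ≈ₚ (p +ₚ (q +ₚ r))
  +ₚ-assoc p q r m = reflexive (≡.cong (λ x → coeff F x m) (ListP.++-assoc p q r))

  +ₚ-comm : ∀ p q → (p +ₚ q) ≈ₚ (q +ₚ p)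
  +ₚ-comm p q = coeffSum⇒≋ (p +ₚ q) (q +ₚ p) λ m → trans (coeffSum-++ p q m) (trans (+-comm _ _) (sym (coeffSum-++ q p m)))

  +ₚ-identityʳ : ∀ p → (p +ₚ 0ₚ) ≈ₚ p
  +ₚ-identityʳ p m = reflexive (≡.cong (λ x → coeff F x m) (ListP.++-identityʳ p))

  -ₚ-cong : ∀ {p q} → p ≈ₚ q → (-ₚ p) ≈ₚ (-ₚ q)
  -ₚ-cong {p} {q} p≈q = coeffSum⇒≋ (-ₚ p) (-ₚ q) λ m →
    trans (coeffSum-neg p m) (trans (-‿cong (≋⇒coeffSum p q p≈q m)) (sym (coeffSum-neg q m)))

  -ₚ-inverseˡ : ∀ p → ((-ₚ p) +ₚ p) ≈ₚ 0ₚ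
  -ₚ-inverseˡ p = coeffSum⇒≋ ((-ₚ p) +ₚ p) 0ₚ λ m →
    trans (coeffSum-++ (-ₚ p) p m) (trans (+-congʳ (coeffSum-neg p m)) (-‿inverseˡ _))

  -ₚ-inverseʳ : ∀ p → (p +ₚ (-ₚ p)) ≈ₚ 0ₚ
  -ₚ-inverseʳ p = coeffSum⇒≋ (p +ₚ (-ₚ p)) 0ₚ λ m →
    trans (coeffSum-++ p (-ₚ p) m) (trans (+-congˡ (coeffSum-neg p m)) (-‿inverseʳ _))

  *ₚ-comm : ∀ p q → (p *ₚ q) ≈ₚ (q *ₚ p)
  *ₚ-comm p q = coeffSum⇒≋ (p *ₚ q) (q *ₚ p) λ m → begin
    coeffSum (p *ₚ q) m ≈⟨ coeffSum-⊗ p q m ⟩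
    sumOver p (λ t → sumOver q (λ u → (proj₁ t * proj₁ u) * δ (addMon F (proj₂ t) (proj₂ u)) m))
      ≈⟨ sumOver-swap p q _ ⟩
    sumOver q (λ u → sumOver p (λ t → (proj₁ t * proj₁ u) * δ (addMon F (proj₂ t) (proj₂ u)) m))
      ≈⟨ sumOver-cong q (λ u → sumOver-cong p (λ t →
           *-cong (*-comm _ _) (reflexive (≡.cong (λ x → δ x m) (addMon-comm (proj₂ t) (proj₂ u)))))) ⟩
    sumOver q (λ u → sumOver p (λ t → (proj₁ u * proj₁ t) * δ (addMon F (proj₂ u) (proj₂ t)) m))
      ≈⟨ coeffSum-⊗ q p m ⟨
    coeffSum (q *ₚ p) m ∎

  *ₚ-congʳ : ∀ {p p′} q → p ≈ₚ p′ → (p *ₚ q) ≈ₚ (p′ *ₚ q)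
  *ₚ-congʳ {p} {p′} q p≈p′ = coeffSum⇒≋ (p *ₚ q) (p′ *ₚ q) λ m →
    trans (coeffSum-⊗-pairing p q m) (trans (pairing-cong p p′ _ p≈p′) (sym (coeffSum-⊗-pairing p′ q m)))

  *ₚ-cong : ∀ {p p′ q q′} → p ≈ₚ p′ → q ≈ₚ q′ → (p *ₚ q) ≈ₚ (p′ *ₚ q′)
  *ₚ-cong {p} {p′} {q} {q′} p≈p′ q≈q′ m =
    trans (*ₚ-congʳ {p} {p′} q p≈p′ m) (trans (*ₚ-comm p′ q m) (trans (*ₚ-congʳ {q} {q′} p′ q≈q′ m) (*ₚ-comm q′ p′ m)))

  *ₚ-assoc : ∀ p q r → ((p *ₚ q) *ₚ r) ≈ₚ (p *ₚ (q *ₚ r))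
  *ₚ-assoc p q r = coeffSum⇒≋ ((p *ₚ q) *ₚ r) (p *ₚ (q *ₚ r)) λ m → begin
    coeffSum ((p *ₚ q) *ₚ r) m ≈⟨ coeffSum-⊗ (p *ₚ q) r m ⟩
    sumOver (p *ₚ q) (λ s → sumOver r (λ u → (proj₁ s * proj₁ u) * δ (addMon F (proj₂ s) (proj₂ u)) m))
      ≈⟨ sumOver-⊗ p q _ ⟩
    sumOver p (λ t → sumOver q (λ v → sumOver r (λ u →
      ((proj₁ t * proj₁ v) * proj₁ u) * δ (addMon F (addMon F (proj₂ t) (proj₂ v)) (proj₂ u)) m)))
      ≈⟨ sumOver-cong p (λ t → sumOver-cong q (λ v → sumOver-cong r (λ u →
           *-cong (*-assoc _ _ _) (reflexive (≡.cong (λ x → δ x m) (addMon-assoc (proj₂ t) (proj₂ v) (proj₂ u))))))) ⟩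
    sumOver p (λ t → sumOver q (λ v → sumOver r (λ u →
      (proj₁ t * (proj₁ v * proj₁ u)) * δ (addMon F (proj₂ t) (addMon F (proj₂ v) (proj₂ u))) m)))
      ≈⟨ sumOver-cong p (λ t → sumOver-⊗ q r (λ s → (proj₁ t * proj₁ s) * δ (addMon F (proj₂ t) (proj₂ s)) m)) ⟨
    sumOver p (λ t → sumOver (q *ₚ r) (λ s → (proj₁ t * proj₁ s) * δ (addMon F (proj₂ t) (proj₂ s)) m))
      ≈⟨ coeffSum-⊗ p (q *ₚ r) m ⟨
    coeffSum (p *ₚ (q *ₚ r)) m ∎

  *ₚ-identityˡ : ∀ p → (1ₚ *ₚ p) ≈ₚ p
  *ₚ-identityˡ p = coeffSum⇒≋ (1ₚ *ₚ p) p λ m → begin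
    coeffSum (1ₚ *ₚ p) m ≈⟨ coeffSum-⊗ 1ₚ p m ⟩
    sumOver p (λ u → (1# * proj₁ u) * δ (addMon F 0ₘ (proj₂ u)) m) + 0# ≈⟨ +-identityʳ _ ⟩
    sumOver p (λ u → (1# * proj₁ u) * δ (addMon F 0ₘ (proj₂ u)) m)
      ≈⟨ sumOver-cong p (λ u → *-cong (*-identityˡ _) (reflexive (≡.cong (λ x → δ x m) (addMon-identityˡ (proj₂ u))))) ⟩
    coeffSum p m ∎

  *ₚ-distribˡ : ∀ p q r → (p *ₚ (q +ₚ r)) ≈ₚ ((p *ₚ q) +ₚ (p *ₚ r))
  *ₚ-distribˡ p q r = coeffSum⇒≋ (p *ₚ (q +ₚ r)) ((p *ₚ q) +ₚ (p *ₚ r)) λ m → begin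
    coeffSum (p *ₚ (q +ₚ r)) m ≈⟨ coeffSum-⊗ p (q +ₚ r) m ⟩
    sumOver p (λ t → sumOver (q ++ r) (λ u → term t u m))
      ≈⟨ sumOver-cong p (λ t → sumOver-++ q r _) ⟩
    sumOver p (λ t → sumOver q (λ u → term t u m) + sumOver r (λ u → term t u m))
      ≈⟨ sumOver-+ p _ _ ⟩
    sumOver p (λ t → sumOver q (λ u → term t u m)) + sumOver p (λ t → sumOver r (λ u → term t u m))
      ≈⟨ +-cong (coeffSum-⊗ p q m) (coeffSum-⊗ p r m) ⟨
    coeffSum (p *ₚ q) m + coeffSum (p *ₚ r) m ≈⟨ coeffSum-++ (p *ₚ q) (p *ₚ r) m ⟨
    coeffSum ((p *ₚ q) +ₚ (p *ₚ r)) m ∎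
    where
    term : Carrier × Mono → Carrier × Mono → Mono → Carrier
    term t u m = (proj₁ t * proj₁ u) * δ (addMon F (proj₂ t) (proj₂ u)) m

  ≈ₚ-isCommutativeRing : IsCommutativeRing _≈ₚ_ _+ₚ_ _*ₚ_ -ₚ_ 0ₚ 1ₚ
  ≈ₚ-isCommutativeRing = record
    { isRing = record
      { +-isAbelianGroup = record
        { isGroup = record
          { isMonoid = record
            { isSemigroup = record
              { isMagma = record { isEquivalence = ≈ₚ-isEquivalence ; ∙-cong = λ {p} {p′} {q} {q′} → +ₚ-cong {p} {p′} {q} {q′} }
              ; assoc = +ₚ-assoc }
            ; identity = (λ p m → refl) , +ₚ-identityʳ }
          ; inverse = -ₚ-inverseˡ , -ₚ-inverseʳ
          ; ⁻¹-cong = λ {p} {q} → -ₚ-cong {p} {q} }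
        ; comm = +ₚ-comm }
      ; *-cong = λ {p} {p′} {q} {q′} → *ₚ-cong {p} {p′} {q} {q′}
      ; *-assoc = *ₚ-assoc
      ; *-identity = *ₚ-identityˡ , λ p m → trans (*ₚ-comm p 1ₚ m) (*ₚ-identityˡ p m)
      ; distrib = *ₚ-distribˡ , λ p q r m →
          trans (*ₚ-comm (q +ₚ r) p m) (trans (*ₚ-distribˡ p q r m) (+ₚ-cong {p *ₚ q} {q *ₚ p} {p *ₚ r} {r *ₚ p} (*ₚ-comm p q) (*ₚ-comm p r) m)) }
    ; *-comm = *ₚ-comm }

  constant : Carrier → Poly
  constant a = (a , 0ₘ) ∷ []

  constant-cong : ∀ {a b} → a ≈ b → constant a ≈ₚ constant b
  constant-cong {a} {b} a≈b = coeffSum⇒≋ (constant a) (constant b) λ m → +-congʳ (*-congʳ a≈b)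

  constant-+ : ∀ a b → constant (a + b) ≈ₚ (constant a +ₚ constant b)
  constant-+ a b = coeffSum⇒≋ (constant (a + b)) (constant a +ₚ constant b) λ m → begin
    (a + b) * δ 0ₘ m + 0#          ≈⟨ +-identityʳ _ ⟩
    (a + b) * δ 0ₘ m               ≈⟨ distribʳ _ _ _ ⟩
    a * δ 0ₘ m + b * δ 0ₘ m        ≈⟨ +-congˡ (+-identityʳ _) ⟨
    a * δ 0ₘ m + (b * δ 0ₘ m + 0#) ∎

  constant-* : ∀ a b → constant (a * b) ≈ₚ (constant a *ₚ constant b)
  constant-* a b = coeffSum⇒≋ (constant (a * b)) (constant a *ₚ constant b) λ m → sym (trans (coeffSum-⊗ (constant a) (constant b) m)
    (trans (+-identityʳ _) (+-congʳ (*-congˡ (reflexive (≡.cong (λ x → δ x m) (addMon-identityˡ 0ₘ)))))))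

  constant-0# : constant 0# ≈ₚ 0ₚ
  constant-0# = coeffSum⇒≋ (constant 0#) 0ₚ λ m → trans (+-identityʳ _) (zeroˡ _)

  scale : Carrier → Poly → Poly
  scale a = map (λ t → (a * proj₁ t , proj₂ t))

  scale≈constant* : ∀ a p → scale a p ≈ₚ (constant a *ₚ p)
  scale≈constant* a p = coeffSum⇒≋ (scale a p) (constant a *ₚ p) λ m → begin
    coeffSum (scale a p) m                                      ≡⟨ sumOver-map _ p _ ⟩
    sumOver p (λ t → (a * proj₁ t) * δ (proj₂ t) m)
      ≈⟨ sumOver-cong p (λ t → *-congˡ (reflexive (≡.cong (λ x → δ x m) (≡.sym (addMon-identityˡ (proj₂ t)))))) ⟩
    sumOver p (λ t → (a * proj₁ t) * δ (addMon F 0ₘ (proj₂ t)) m) ≈⟨ +-identityʳ _ ⟨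
    sumOver p (λ t → (a * proj₁ t) * δ (addMon F 0ₘ (proj₂ t)) m) + 0# ≈⟨ coeffSum-⊗ (constant a) p m ⟨
    coeffSum (constant a *ₚ p) m ∎

  natMul-cong : ∀ k {a b} → a ≈ b → natMul F k a ≈ natMul F k b
  natMul-cong zero    a≈b = refl
  natMul-cong (suc k) a≈b = +-cong a≈b (natMul-cong k a≈b)

  natMul-+ : ∀ j k a → natMul F (j ℕ.+ k) a ≈ natMul F j a + natMul F k a
  natMul-+ zero    k a = sym (+-identityˡ _)
  natMul-+ (suc j) k a = trans (+-congˡ (natMul-+ j k a)) (sym (+-assoc _ _ _))

  natMul-*ˡ : ∀ k a b → natMul F k (a * b) ≈ natMul F k a * b
  natMul-*ˡ zero    a b = sym (zeroˡ b)
  natMul-*ˡ (suc k) a b = trans (+-congˡ (natMul-*ˡ k a b)) (sym (distribʳ _ _ _))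

  natMul-*ʳ : ∀ k a b → natMul F k (a * b) ≈ a * natMul F k b
  natMul-*ʳ zero    a b = sym (zeroʳ a)
  natMul-*ʳ (suc k) a b = trans (+-congˡ (natMul-*ʳ k a b)) (sym (distribˡ _ _ _))

  natMul≈*natMul1# : ∀ k a → natMul F k a ≈ a * natMul F k 1#
  natMul≈*natMul1# k a = trans (natMul-cong k (sym (*-identityʳ a))) (natMul-*ʳ k a 1#)

  ∂ : Poly → Poly
  ∂ = ∂y F

  coeffSum-∂ : ∀ p m →
    coeffSum (∂ p) m ≡ sumOver p (λ t → natMul F (proj₁ (proj₂ t)) (proj₁ t) * δ (proj₁ (proj₂ t) ∸ 1 , proj₂ (proj₂ t)) m)
  coeffSum-∂ p m = sumOver-map _ p _

  -- The coefficients of ∂ p are the pairing of p with a fixed function, hence respect ≈ₚ.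
  ∂-cong : ∀ {p q} → p ≈ₚ q → ∂ p ≈ₚ ∂ q
  ∂-cong {p} {q} p≈q = coeffSum⇒≋ (∂ p) (∂ q) λ m → begin
    coeffSum (∂ p) m   ≡⟨ coeffSum-∂ p m ⟩
    _                  ≈⟨ sumOver-cong p (λ t → trans (*-congʳ (natMul≈*natMul1# (proj₁ (proj₂ t)) (proj₁ t))) (*-assoc _ _ _)) ⟩
    pairing p (h m)    ≈⟨ pairing-cong p q (h m) p≈q ⟩
    pairing q (h m)    ≈⟨ sumOver-cong q (λ t → trans (*-congʳ (natMul≈*natMul1# (proj₁ (proj₂ t)) (proj₁ t))) (*-assoc _ _ _)) ⟨
    _                  ≡⟨ ≡.sym (coeffSum-∂ q m) ⟩
    coeffSum (∂ q) m   ∎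
    where
    h : Mono → Mono → Carrier
    h m m′ = natMul F (proj₁ m′) 1# * δ (proj₁ m′ ∸ 1 , proj₂ m′) m

  ∂-constant : ∀ a → ∂ (constant a) ≈ₚ 0ₚ
  ∂-constant a = coeffSum⇒≋ (∂ (constant a)) 0ₚ λ m → trans (+-identityʳ _) (zeroˡ _)

  leibniz-term : ∀ a b k₁ k₂ (w : Vec ℕ n) m →
    natMul F (k₁ ℕ.+ k₂) (a * b) * δ ((k₁ ℕ.+ k₂) ∸ 1 , w) m
      ≈ (natMul F k₁ a * b) * δ ((k₁ ∸ 1) ℕ.+ k₂ , w) m + (a * natMul F k₂ b) * δ (k₁ ℕ.+ (k₂ ∸ 1) , w) m
  leibniz-term a b zero k₂ w m = begin
    natMul F k₂ (a * b) * δ (k₂ ∸ 1 , w) m                    ≈⟨ *-congʳ (natMul-*ʳ k₂ a b) ⟩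
    (a * natMul F k₂ b) * δ (k₂ ∸ 1 , w) m                    ≈⟨ +-identityˡ _ ⟨
    0# + (a * natMul F k₂ b) * δ (k₂ ∸ 1 , w) m               ≈⟨ +-congʳ (trans (*-congʳ (zeroˡ b)) (zeroˡ _)) ⟨
    (0# * b) * δ (k₂ , w) m + (a * natMul F k₂ b) * δ (k₂ ∸ 1 , w) m ∎
  leibniz-term a b (suc k₁) zero w m = begin
    natMul F (suc k₁ ℕ.+ 0) (a * b) * δ (k₁ ℕ.+ 0 , w) m      ≈⟨ *-congʳ (trans (natMul-+ (suc k₁) 0 (a * b)) (+-identityʳ _)) ⟩
    natMul F (suc k₁) (a * b) * δ (k₁ ℕ.+ 0 , w) m            ≈⟨ *-congʳ (natMul-*ˡ (suc k₁) a b) ⟩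
    (natMul F (suc k₁) a * b) * δ (k₁ ℕ.+ 0 , w) m            ≈⟨ +-identityʳ _ ⟨
    (natMul F (suc k₁) a * b) * δ (k₁ ℕ.+ 0 , w) m + 0#       ≈⟨ +-congˡ (trans (*-congʳ (zeroʳ a)) (zeroˡ _)) ⟨
    (natMul F (suc k₁) a * b) * δ (k₁ ℕ.+ 0 , w) m + (a * 0#) * δ (suc k₁ ℕ.+ 0 , w) m ∎
  leibniz-term a b (suc k₁) (suc k₂) w m = begin
    natMul F (suc k₁ ℕ.+ suc k₂) (a * b) * δ (k₁ ℕ.+ suc k₂ , w) m
      ≈⟨ trans (*-congʳ (natMul-+ (suc k₁) (suc k₂) (a * b))) (distribʳ _ _ _) ⟩
    natMul F (suc k₁) (a * b) * δ (k₁ ℕ.+ suc k₂ , w) m + natMul F (suc k₂) (a * b) * δ (k₁ ℕ.+ suc k₂ , w) m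
      ≈⟨ +-cong (*-congʳ (natMul-*ˡ (suc k₁) a b))
                (*-cong (natMul-*ʳ (suc k₂) a b) (reflexive (≡.cong (λ x → δ (x , w) m) (ℕP.+-suc k₁ k₂)))) ⟩
    (natMul F (suc k₁) a * b) * δ (k₁ ℕ.+ suc k₂ , w) m + (a * natMul F (suc k₂) b) * δ (suc k₁ ℕ.+ k₂ , w) m ∎

  leibniz : ∀ p q → ∂ (p *ₚ q) ≈ₚ ((∂ p *ₚ q) +ₚ (p *ₚ ∂ q))
  leibniz p q = coeffSum⇒≋ (∂ (p *ₚ q)) ((∂ p *ₚ q) +ₚ (p *ₚ ∂ q)) λ m → begin
    coeffSum (∂ (p *ₚ q)) m ≡⟨ coeffSum-∂ (p *ₚ q) m ⟩
    sumOver (p *ₚ q) (λ t → natMul F (proj₁ (proj₂ t)) (proj₁ t) * δ (proj₁ (proj₂ t) ∸ 1 , proj₂ (proj₂ t)) m)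
      ≈⟨ sumOver-⊗ p q _ ⟩
    sumOver p (λ t → sumOver q (λ u → natMul F (k t ℕ.+ k u) (proj₁ t * proj₁ u) * δ ((k t ℕ.+ k u) ∸ 1 , w t u) m))
      ≈⟨ sumOver-cong p (λ t → sumOver-cong q (λ u → leibniz-term (proj₁ t) (proj₁ u) (k t) (k u) (w t u) m)) ⟩
    sumOver p (λ t → sumOver q (λ u → ∂ˡ m t u + ∂ʳ m t u))
      ≈⟨ trans (sumOver-cong p (λ t → sumOver-+ q (∂ˡ m t) (∂ʳ m t))) (sumOver-+ p _ _) ⟩
    sumOver p (λ t → sumOver q (∂ˡ m t)) + sumOver p (λ t → sumOver q (∂ʳ m t))
      ≈⟨ +-cong (trans (coeffSum-⊗ (∂ p) q m) (reflexive (sumOver-map _ p _)))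
                (trans (coeffSum-⊗ p (∂ q) m) (sumOver-cong p (λ t → reflexive (sumOver-map _ q _)))) ⟨
    coeffSum (∂ p *ₚ q) m + coeffSum (p *ₚ ∂ q) m ≈⟨ coeffSum-++ (∂ p *ₚ q) (p *ₚ ∂ q) m ⟨
    coeffSum ((∂ p *ₚ q) +ₚ (p *ₚ ∂ q)) m ∎
    where
    k : Carrier × Mono → ℕ
    k t = proj₁ (proj₂ t)
    w : Carrier × Mono → Carrier × Mono → Vec ℕ n
    w t u = zipWith ℕ._+_ (proj₂ (proj₂ t)) (proj₂ (proj₂ u))
    ∂ˡ ∂ʳ : Mono → Carrier × Mono → Carrier × Mono → Carrier
    ∂ˡ m t u = (natMul F (k t) (proj₁ t) * proj₁ u) * δ ((k t ∸ 1) ℕ.+ k u , w t u) m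
    ∂ʳ m t u = (proj₁ t * natMul F (k u) (proj₁ u)) * δ (k t ℕ.+ (k u ∸ 1) , w t u) m

  -- The ring operations are sealed, so that unification works with them rather than
  -- with the list manipulations they stand for.
  opaque
    _≈′_ : Poly → Poly → Set ℓ
    _≈′_ = _≈ₚ_

    _+′_ _*′_ : Poly → Poly → Poly
    _+′_ = _+ₚ_
    _*′_ = _*ₚ_

    -′_ : Poly → Poly
    -′_ = -ₚ_

    ≈′-isCommutativeRing : IsCommutativeRing _≈′_ _+′_ _*′_ -′_ 0ₚ 1ₚ
    ≈′-isCommutativeRing = ≈ₚ-isCommutativeRing

  polynomialRing : CommutativeRing c ℓ
  polynomialRing = record { isCommutativeRing = ≈′-isCommutativeRing }

  opaque
    unfolding _≈′_ _+′_ _*′_ -′_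

    ≈ₚ⇒≈′ : ∀ {p q} → p ≈ₚ q → p ≈′ q
    ≈ₚ⇒≈′ p≈q = p≈q

    ≈′⇒≈ₚ : ∀ {p q} → p ≈′ q → p ≈ₚ q
    ≈′⇒≈ₚ p≈q = p≈q

    +′≡+ₚ : ∀ p q → p +′ q ≡ p +ₚ q
    +′≡+ₚ p q = ≡.refl

    *′≡*ₚ : ∀ p q → p *′ q ≡ p *ₚ q
    *′≡*ₚ p q = ≡.refl

    ∂-cong′ : ∀ {p q} → p ≈′ q → ∂ p ≈′ ∂ q
    ∂-cong′ {p} {q} = ∂-cong {p} {q}

    leibniz′ : ∀ p q → ∂ (p *′ q) ≈′ ((∂ p *′ q) +′ (p *′ ∂ q))
    leibniz′ = leibniz

    ∂-1′ : ∂ 1ₚ ≈′ 0ₚ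
    ∂-1′ = ∂-constant 1#

    scale≈constant*′ : ∀ a p → scale a p ≈′ (constant a *′ p)
    scale≈constant*′ = scale≈constant*

    constant-isRingHomomorphism : IsRingHomomorphism rawRing (CommutativeRing.rawRing polynomialRing) constant
    constant-isRingHomomorphism = record
      { isSemiringHomomorphism = record
        { isNearSemiringHomomorphism = record
          { +-isMonoidHomomorphism = record
            { isMagmaHomomorphism = record
              { isRelHomomorphism = record { cong = constant-cong }
              ; homo = constant-+ }
            ; ε-homo = constant-0# }
          ; *-homo = constant-* }
        ; 1#-homo = λ m → refl }
      ; -‿homo = λ a m → refl }

module DerivativeCircuit {c ℓ} (F : Field c ℓ) (n : ℕ) where
  open Field F
  open import Data.Nat.Combinatorics using (_C_)
  open PolynomialRing F n
  open FiniteDifference commutativeRing using (fromℕ; sign; moment)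

  ∂YPoly : YPoly F → YPoly F
  ∂YPoly = map (λ t → (natMul F (proj₂ t) (proj₁ t) , proj₂ t ∸ 1))

  scaleYPoly : Carrier → YPoly F → YPoly F
  scaleYPoly a = map (λ t → (a * proj₁ t , proj₂ t))

  ∂XUni : XUni F → XUni F
  ∂XUni = map (λ t → (∂YPoly (proj₁ t) , proj₂ t))

  scaleXUni : Carrier → XUni F → XUni F
  scaleXUni a = map (λ t → (scaleYPoly a (proj₁ t) , proj₂ t))

  jg+∂g : (Fin n → XUni F) → ℕ → Fin n → XUni F
  jg+∂g g j i = scaleXUni (fromℕ j) (g i) ++ ∂XUni (g i)

  -- With u the inverse of (-1)^N N!, this circuit computes ∂y (α G^(N+1)) by
  -- power-derivative-interpolation.
  ∂powerCircuit : YPoly F → ℕ → (Fin n → XUni F) → Carrier → Circuit F n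
  ∂powerCircuit α N g u =
    summand (∂YPoly α) (suc N) g ∷
    summand (scaleYPoly (- (u * moment N (suc N))) α) (suc N) g ∷
    applyUpTo (λ j → summand (scaleYPoly (u * (sign j * fromℕ (N C j))) α) (suc N) (jg+∂g g j)) (suc N)

  _*YPoly_ : YPoly F → YPoly F → YPoly F
  a *YPoly b = concatMap (λ t → map (λ u → (proj₁ t * proj₁ u , proj₂ t ℕ.+ proj₂ u)) b) a

  _^YPoly_ : YPoly F → ℕ → YPoly F
  Γ ^YPoly zero  = (1# , 0) ∷ []
  Γ ^YPoly suc e = Γ *YPoly (Γ ^YPoly e)

  -- If G = g₁(x₁) + ⋯ + gₙ(xₙ) does not involve x, it is the element of F[y]
  -- obtained by collecting all coefficients of the gᵢ.
  constantPart : (Fin n → XUni F) → YPoly F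
  constantPart g = concatMap (λ i → concatMap proj₁ (g i)) (allFin n)

  maxDegree : (Fin n → XUni F) → ℕ
  maxDegree g = foldr ℕ._⊔_ 0 (map (λ i → degUni F (g i)) (allFin n))

  -- The single summand ∂y (α Γ) · G^0: exponent 0 keeps its size independent of that of Γ.
  ∂constantCircuit : YPoly F → YPoly F → (Fin n → XUni F) → Circuit F n
  ∂constantCircuit α Γ g = summand (∂YPoly (α *YPoly Γ)) 0 g ∷ []

  private
    m⊔n≡0⇒m≡0×n≡0 : ∀ m n → m ℕ.⊔ n ≡ 0 → m ≡ 0 × n ≡ 0
    m⊔n≡0⇒m≡0×n≡0 zero    zero    _  = ≡.refl , ≡.refl
    m⊔n≡0⇒m≡0×n≡0 zero    (suc n) ()
    m⊔n≡0⇒m≡0×n≡0 (suc m) zero    ()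
    m⊔n≡0⇒m≡0×n≡0 (suc m) (suc n) ()

  embedY-∂ : ∀ α → embedY F {n} (∂YPoly α) ≡ ∂ (embedY F α)
  embedY-∂ []      = ≡.refl
  embedY-∂ (t ∷ α) = ≡.cong (_ ∷_) (embedY-∂ α)

  embedY-scale : ∀ a α → embedY F {n} (scaleYPoly a α) ≡ scale a (embedY F α)
  embedY-scale a []      = ≡.refl
  embedY-scale a (t ∷ α) = ≡.cong (_ ∷_) (embedY-scale a α)

  embedY-++ : ∀ α β → embedY F {n} (α ++ β) ≡ embedY F α ++ embedY F β
  embedY-++ α β = ListP.map-++ _ α β

  embedY-* : ∀ α β → embedY F {n} (α *YPoly β) ≡ embedY F α *ₚ embedY F β
  embedY-* []      β = ≡.refl
  embedY-* (t ∷ α) β = ≡.trans (embedY-++ _ (α *YPoly β)) (≡.cong₂ _++_ (term β) (embedY-* α β))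
    where
    term : ∀ β → embedY F {n} (map (λ u → (proj₁ t * proj₁ u , proj₂ t ℕ.+ proj₂ u)) β)
               ≡ map (λ u → (proj₁ t * proj₁ u , addMon F (proj₂ t , replicate n 0) (proj₂ u))) (embedY F β)
    term []      = ≡.refl
    term (u ∷ β) = ≡.cong₂ _∷_
      (≡.cong (λ v → (proj₁ t * proj₁ u , (proj₂ t ℕ.+ proj₂ u , v))) (≡.sym (VecP.zipWith-identityˡ ℕP.+-identityˡ _)))
      (term β)

  embedY-^ : ∀ Γ e → embedY F {n} (Γ ^YPoly e) ≡ _^^_ F (embedY F Γ) e
  embedY-^ Γ zero    = ≡.refl
  embedY-^ Γ (suc e) = ≡.trans (embedY-* Γ (Γ ^YPoly e)) (≡.cong (embedY F Γ *ₚ_) (embedY-^ Γ e))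

  module _ (i : Fin n) where

    private
      embedTerm : ℕ → Carrier × ℕ → Carrier × Mono
      embedTerm k t = (proj₁ t , (proj₂ t , replicate n 0 [ i ]≔ k))

    embedX-++ : ∀ u u′ → embedX F i (u ++ u′) ≡ embedX F i u ++ embedX F i u′
    embedX-++ []      u′ = ≡.refl
    embedX-++ (t ∷ u) u′ =
      ≡.trans (≡.cong (_ ++_) (embedX-++ u u′)) (≡.sym (ListP.++-assoc (map (embedTerm (proj₂ t)) (proj₁ t)) _ _))

    embedX-∂ : ∀ u → embedX F i (∂XUni u) ≡ ∂ (embedX F i u)
    embedX-∂ []            = ≡.refl
    embedX-∂ ((a , k) ∷ u) = ≡.trans (≡.cong₂ _++_ (term a) (embedX-∂ u)) (≡.sym (ListP.map-++ _ _ (embedX F i u)))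
      where
      term : ∀ a → map (embedTerm k) (∂YPoly a) ≡ ∂ (map (embedTerm k) a)
      term []      = ≡.refl
      term (t ∷ a) = ≡.cong (_ ∷_) (term a)

    embedX-scale : ∀ b u → embedX F i (scaleXUni b u) ≡ scale b (embedX F i u)
    embedX-scale b []            = ≡.refl
    embedX-scale b ((a , k) ∷ u) = ≡.trans (≡.cong₂ _++_ (term a) (embedX-scale b u)) (≡.sym (ListP.map-++ _ _ (embedX F i u)))
      where
      term : ∀ a → map (embedTerm k) (scaleYPoly b a) ≡ scale b (map (embedTerm k) a)
      term []      = ≡.refl
      term (t ∷ a) = ≡.cong (_ ∷_) (term a)

    embedX-degree0 : ∀ u → degUni F u ≡ 0 → embedX F i u ≡ embedY F (concatMap proj₁ u)
    embedX-degree0 []            _   = ≡.refl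
    embedX-degree0 ((a , k) ∷ u) deg with m⊔n≡0⇒m≡0×n≡0 k (degUni F u) deg
    ... | ≡.refl , deg-u = ≡.trans (≡.cong₂ _++_ (term a) (embedX-degree0 u deg-u)) (≡.sym (embedY-++ a _))
      where
      term : ∀ a → map (embedTerm 0) a ≡ embedY F a
      term []      = ≡.refl
      term (t ∷ a) = ≡.cong₂ _∷_ (≡.cong (λ v → (proj₁ t , (proj₂ t , v))) (replicate-[]≔0 i)) (term a)
        where
        replicate-[]≔0 : ∀ {k} (i : Fin k) → replicate k 0 [ i ]≔ 0 ≡ replicate k 0
        replicate-[]≔0 Fin.zero    = ≡.refl
        replicate-[]≔0 (Fin.suc i) = ≡.cong (0 ∷ᵥ_) (replicate-[]≔0 i)

  ⟦⟧g-degree0 : ∀ (g : Fin n → XUni F) (is : List (Fin n)) → foldr ℕ._⊔_ 0 (map (λ i → degUni F (g i)) is) ≡ 0 →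
    concatMap (λ i → embedX F i (g i)) is ≡ embedY F (concatMap (λ i → concatMap proj₁ (g i)) is)
  ⟦⟧g-degree0 g []       _   = ≡.refl
  ⟦⟧g-degree0 g (i ∷ is) deg with m⊔n≡0⇒m≡0×n≡0 (degUni F (g i)) (foldr ℕ._⊔_ 0 (map (λ i → degUni F (g i)) is)) deg
  ... | deg-i , deg-is = ≡.trans (≡.cong₂ _++_ (embedX-degree0 i (g i) deg-i) (⟦⟧g-degree0 g is deg-is))
                                 (≡.sym (embedY-++ (concatMap proj₁ (g i)) (concatMap (λ i → concatMap proj₁ (g i)) is)))

  ⟦jg+∂g⟧ : ∀ g j → ⟦_⟧g F (jg+∂g g j) ≈ₚ (scale (fromℕ j) (⟦_⟧g F g) +ₚ ∂ (⟦_⟧g F g))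
  ⟦jg+∂g⟧ g j = coeffSum⇒≋ (⟦_⟧g F (jg+∂g g j)) (scale (fromℕ j) G +ₚ ∂ G) λ m → begin
    coeffSum (concatMap (λ i → embedX F i (jg+∂g g j i)) is) m
      ≈⟨ sumOver-concatMap _ is _ ⟩
    sumOver is (λ i → coeffSum (embedX F i (jg+∂g g j i)) m)
      ≈⟨ sumOver-cong is (λ i → reflexive (≡.cong (λ p → coeffSum p m) (embed-jg+∂g i))) ⟩
    sumOver is (λ i → coeffSum (scale (fromℕ j) (embedX F i (g i)) ++ ∂ (embedX F i (g i))) m)
      ≈⟨ sumOver-cong is (λ i → coeffSum-++ (scale (fromℕ j) (embedX F i (g i))) (∂ (embedX F i (g i))) m) ⟩
    sumOver is (λ i → coeffSum (scale (fromℕ j) (embedX F i (g i))) m + coeffSum (∂ (embedX F i (g i))) m)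
      ≈⟨ sumOver-+ is _ _ ⟩
    sumOver is (λ i → coeffSum (scale (fromℕ j) (embedX F i (g i))) m) + sumOver is (λ i → coeffSum (∂ (embedX F i (g i))) m)
      ≈⟨ +-cong (map-over-⟦⟧g _ m) (map-over-⟦⟧g _ m) ⟨
    coeffSum (scale (fromℕ j) G) m + coeffSum (∂ G) m
      ≈⟨ coeffSum-++ (scale (fromℕ j) G) (∂ G) m ⟨
    coeffSum (scale (fromℕ j) G +ₚ ∂ G) m ∎
    where
    open import Relation.Binary.Reasoning.Setoid setoid
    is = allFin n
    G = ⟦_⟧g F g
    embed-jg+∂g : ∀ i → embedX F i (jg+∂g g j i) ≡ scale (fromℕ j) (embedX F i (g i)) ++ ∂ (embedX F i (g i))
    embed-jg+∂g i = ≡.trans (embedX-++ i (scaleXUni (fromℕ j) (g i)) (∂XUni (g i)))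
                            (≡.cong₂ _++_ (embedX-scale i (fromℕ j) (g i)) (embedX-∂ i (g i)))
    map-over-⟦⟧g : ∀ f m → coeffSum (map f G) m ≈ sumOver is (λ i → coeffSum (map f (embedX F i (g i))) m)
    map-over-⟦⟧g f m = trans (reflexive (≡.cong (λ p → coeffSum p m) (ListP.map-concatMap f (λ i → embedX F i (g i)) is)))
                           (sumOver-concatMap _ is _)

  module _ where
    open import Data.Nat.ListAction using (sum)
    open import Data.Nat.ListAction.Properties using (sum-++)
    open ℕP.≤-Reasoning

    sizeG : (Fin n → XUni F) → ℕ
    sizeG g = sum (map (λ i → sizeUni F (g i)) (allFin n))

    sizeUni-++ : ∀ u u′ → sizeUni F (u ++ u′) ≡ sizeUni F u ℕ.+ sizeUni F u′
    sizeUni-++ u u′ = ≡.trans (≡.cong sum (ListP.map-++ _ u u′)) (sum-++ (map _ u) (map _ u′))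

    sizeUni-scale : ∀ a u → sizeUni F (scaleXUni a u) ≡ sizeUni F u
    sizeUni-scale a []      = ≡.refl
    sizeUni-scale a (t ∷ u) = ≡.cong (suc (proj₂ t) ℕ.+_) (sizeUni-scale a u)

    sizeUni-∂ : ∀ u → sizeUni F (∂XUni u) ≡ sizeUni F u
    sizeUni-∂ []      = ≡.refl
    sizeUni-∂ (t ∷ u) = ≡.cong (suc (proj₂ t) ℕ.+_) (sizeUni-∂ u)

    sum-map-+ : ∀ {a} {A : Set a} (xs : List A) (f h : A → ℕ) →
      sum (map (λ x → f x ℕ.+ h x) xs) ≡ sum (map f xs) ℕ.+ sum (map h xs)
    sum-map-+ []       f h = ≡.refl
    sum-map-+ (x ∷ xs) f h = ≡.trans (≡.cong (f x ℕ.+ h x ℕ.+_) (sum-map-+ xs f h)) (ℕ+.interchange (f x) (h x) _ _)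

    sizeG-jg+∂g : ∀ g j → sizeG (jg+∂g g j) ≡ sizeG g ℕ.+ sizeG g
    sizeG-jg+∂g g j = ≡.trans
      (≡.cong sum (ListP.map-cong (λ i → ≡.trans (sizeUni-++ (scaleXUni _ (g i)) (∂XUni (g i)))
                                                  (≡.cong₂ ℕ._+_ (sizeUni-scale _ (g i)) (sizeUni-∂ (g i)))) (allFin n)))
      (sum-map-+ (allFin n) (λ i → sizeUni F (g i)) (λ i → sizeUni F (g i)))

    size-applyUpTo : ∀ (f : ℕ → Summand F n) k b → (∀ j → sizeS F (f j) ≤ b) → size F (applyUpTo f k) ≤ k ℕ.* b
    size-applyUpTo f zero    b _      = z≤n
    size-applyUpTo f (suc k) b size≤b = ℕP.+-mono-≤ (size≤b 0) (size-applyUpTo (λ j → f (suc j)) k b (λ j → size≤b (suc j)))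

    size-++ : ∀ (σs τs : Circuit F n) → size F (σs ++ τs) ≡ size F σs ℕ.+ size F τs
    size-++ σs τs = ≡.trans (≡.cong sum (ListP.map-++ (sizeS F) σs τs)) (sum-++ (map (sizeS F) σs) (map (sizeS F) τs))

    size-∂constantCircuit : ∀ α Γ e g → size F (∂constantCircuit α Γ g) ≤ sizeS F (summand α e g)
    size-∂constantCircuit α Γ e g = begin
      suc (0 ℕ.+ sizeG g) ℕ.+ 0 ≡⟨ ℕP.+-identityʳ _ ⟩
      suc (sizeG g)             ≤⟨ s≤s (ℕP.m≤n+m (sizeG g) e) ⟩
      suc (e ℕ.+ sizeG g)       ∎

    -- Each of the e + 2 summands has size at most twice that of α G^e.
    size-∂powerCircuit : ∀ α N g u → size F (∂powerCircuit α N g u) ≤ 2 ℕ.* suc (suc N) ℕ.* sizeS F (summand α (suc N) g)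
    size-∂powerCircuit α N g u = begin
      Z ℕ.+ (Z ℕ.+ size F (applyUpTo σⱼ e)) ≤⟨ ℕP.+-monoʳ-≤ Z (ℕP.+-monoʳ-≤ Z (size-applyUpTo σⱼ e (2 ℕ.* Z) size-σⱼ)) ⟩
      Z ℕ.+ (Z ℕ.+ e ℕ.* (2 ℕ.* Z))        ≡⟨ Z+[Z+e*2Z]≡2*[1+e]*Z Z e ⟩
      2 ℕ.* suc e ℕ.* Z                     ∎
      where
      e = suc N
      Z = sizeS F (summand α e g)
      σⱼ : ℕ → Summand F n
      σⱼ j = summand (scaleYPoly (u * (sign j * fromℕ (N C j))) α) e (jg+∂g g j)
      Z+[Z+e*2Z]≡2*[1+e]*Z : ∀ Z e → Z ℕ.+ (Z ℕ.+ e ℕ.* (2 ℕ.* Z)) ≡ 2 ℕ.* suc e ℕ.* Z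
      Z+[Z+e*2Z]≡2*[1+e]*Z = solve-∀
      [1+e+[S+S]]+[1+e]≡2*[1+e+S] : ∀ e S → suc (e ℕ.+ (S ℕ.+ S)) ℕ.+ suc e ≡ 2 ℕ.* suc (e ℕ.+ S)
      [1+e+[S+S]]+[1+e]≡2*[1+e+S] = solve-∀
      size-σⱼ : ∀ j → sizeS F (σⱼ j) ≤ 2 ℕ.* Z
      size-σⱼ j = begin
        suc (e ℕ.+ sizeG (jg+∂g g j))                   ≡⟨ ≡.cong (λ s → suc (e ℕ.+ s)) (sizeG-jg+∂g g j) ⟩
        suc (e ℕ.+ (sizeG g ℕ.+ sizeG g))               ≤⟨ ℕP.m≤m+n _ (suc e) ⟩
        suc (e ℕ.+ (sizeG g ℕ.+ sizeG g)) ℕ.+ suc e     ≡⟨ [1+e+[S+S]]+[1+e]≡2*[1+e+S] e (sizeG g) ⟩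
        2 ℕ.* suc (e ℕ.+ sizeG g)                       ∎

module CircuitSemantics {c ℓ} (F : Field c ℓ) (n : ℕ) where
  private
    module 𝔽 = Field F
    module Δ𝔽 = FiniteDifference 𝔽.commutativeRing
  open import Data.Nat.Combinatorics using (_C_)
  open PolynomialRing F n
  open DerivativeCircuit F n
  open CommutativeRing polynomialRing
  open FiniteDifference polynomialRing
    using (_^_; ^-congˡ; sumBelow; sumBelow-zero; sumBelow-suc; sumBelow-cong; fromℕ; sign; moment; signedFactorial;
           power-derivative-interpolation; derivation-^)
  open FiniteDifference-homomorphism 𝔽.commutativeRing polynomialRing constant-isRingHomomorphism
  open IsRingHomomorphism constant-isRingHomomorphism using (⟦⟧-cong; *-homo; -‿homo; 1#-homo)
  open import Relation.Binary.Reasoning.Setoid setoid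

  ^^≡^ : ∀ p e → _^^_ F p e ≡ p ^ e
  ^^≡^ p zero    = ≡.refl
  ^^≡^ p (suc e) = ≡.trans (≡.cong (p *ₚ_) (^^≡^ p e)) (≡.sym (*′≡*ₚ p (p ^ e)))

  ⟦summand⟧ : ∀ α e g → ⟦_⟧s F (summand α e g) ≡ embedY F α * ⟦_⟧g F g ^ e
  ⟦summand⟧ α e g = ≡.trans (≡.cong (embedY F α *ₚ_) (^^≡^ (⟦_⟧g F g) e)) (≡.sym (*′≡*ₚ _ _))

  ⟦∷⟧ : ∀ σ σs → ⟦_⟧ F (σ ∷ σs) ≡ ⟦_⟧s F σ + ⟦_⟧ F σs
  ⟦∷⟧ σ σs = ≡.sym (+′≡+ₚ (⟦_⟧s F σ) (⟦_⟧ F σs))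

  ⟦++⟧ : ∀ σs τs → ⟦_⟧ F (σs ++ τs) ≈ ⟦_⟧ F σs + ⟦_⟧ F τs
  ⟦++⟧ []      τs = sym (+-identityˡ _)
  ⟦++⟧ (σ ∷ σs) τs = begin
    ⟦_⟧ F (σ ∷ (σs ++ τs))                 ≡⟨ ⟦∷⟧ σ (σs ++ τs) ⟩
    ⟦_⟧s F σ + ⟦_⟧ F (σs ++ τs)            ≈⟨ +-congˡ (⟦++⟧ σs τs) ⟩
    ⟦_⟧s F σ + (⟦_⟧ F σs + ⟦_⟧ F τs)       ≈⟨ +-assoc _ _ _ ⟨
    (⟦_⟧s F σ + ⟦_⟧ F σs) + ⟦_⟧ F τs       ≡⟨ ≡.cong (_+ ⟦_⟧ F τs) (≡.sym (⟦∷⟧ σ σs)) ⟩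
    ⟦_⟧ F (σ ∷ σs) + ⟦_⟧ F τs              ∎

  ⟦applyUpTo⟧ : ∀ (f : ℕ → Summand F n) k → ⟦_⟧ F (applyUpTo f k) ≈ sumBelow k (λ j → ⟦_⟧s F (f j))
  ⟦applyUpTo⟧ f zero    = sym (sumBelow-zero _)
  ⟦applyUpTo⟧ f (suc k) = begin
    ⟦_⟧ F (f 0 ∷ applyUpTo (λ j → f (suc j)) k)             ≡⟨ ⟦∷⟧ (f 0) (applyUpTo (λ j → f (suc j)) k) ⟩
    ⟦_⟧s F (f 0) + ⟦_⟧ F (applyUpTo (λ j → f (suc j)) k)     ≈⟨ +-congˡ (⟦applyUpTo⟧ (λ j → f (suc j)) k) ⟩
    ⟦_⟧s F (f 0) + sumBelow k (λ j → ⟦_⟧s F (f (suc j)))    ≈⟨ sumBelow-suc k (λ j → ⟦_⟧s F (f j)) ⟨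
    sumBelow (suc k) (λ j → ⟦_⟧s F (f j))                   ∎

  embedY-scale≈constant* : ∀ a α → embedY F (scaleYPoly a α) ≈ constant a * embedY F α
  embedY-scale≈constant* a α = trans (reflexive (embedY-scale a α)) (scale≈constant*′ a (embedY F α))

  ⟦jg+∂g⟧≈ : ∀ g j → ⟦_⟧g F (jg+∂g g j) ≈ fromℕ j * ⟦_⟧g F g + ∂ (⟦_⟧g F g)
  ⟦jg+∂g⟧≈ g j = begin
    ⟦_⟧g F (jg+∂g g j)                             ≈⟨ ≈ₚ⇒≈′ (⟦jg+∂g⟧ g j) ⟩
    scale (Δ𝔽.fromℕ j) G +ₚ ∂ G                    ≡⟨ +′≡+ₚ _ _ ⟨
    scale (Δ𝔽.fromℕ j) G + ∂ G                     ≈⟨ +-congʳ (trans (scale≈constant*′ _ G) (*-congʳ (fromℕ-homo j))) ⟩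
    fromℕ j * G + ∂ G                              ∎
    where
    G = ⟦_⟧g F g

  ∂-^ : ∀ N p → ∂ (p ^ suc N) ≈ fromℕ (suc N) * (p ^ N * ∂ p)
  ∂-^ = derivation-^ ∂ leibniz′ ∂-1′

  ⟦∂powerCircuit⟧ : ∀ α N g u → u 𝔽.* Δ𝔽.signedFactorial N 𝔽.≈ 𝔽.1# →
    ⟦_⟧ F (∂powerCircuit α N g u) ≈ ∂ (⟦_⟧s F (summand α (suc N) g))
  ⟦∂powerCircuit⟧ α N g u u*s≈1 = begin
    ⟦_⟧ F (∂powerCircuit α N g u)
      ≡⟨ ≡.trans (⟦∷⟧ σ₁ (σ₂ ∷ applyUpTo σⱼ e)) (≡.cong (⟦_⟧s F σ₁ +_) (⟦∷⟧ σ₂ (applyUpTo σⱼ e))) ⟩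
    ⟦_⟧s F σ₁ + (⟦_⟧s F σ₂ + ⟦_⟧ F (applyUpTo σⱼ e))
      ≈⟨ +-cong (reflexive ⟦σ₁⟧) (+-cong ⟦σ₂⟧ (trans (⟦applyUpTo⟧ σⱼ e) (sumBelow-cong e ⟦σⱼ⟧))) ⟩
    ∂ A * G ^ e + (((- (û * moment N e)) * A) * G ^ e
                   + sumBelow e (λ j → ((û * (sign j * fromℕ (N C j))) * A) * (fromℕ j * G + ∂ G) ^ e))
      ≈⟨ +-congˡ (power-derivative-interpolation N A G (∂ G) û û*s≈1) ⟩
    ∂ A * G ^ e + A * (fromℕ e * (G ^ N * ∂ G)) ≈⟨ +-congˡ (*-congˡ (∂-^ N G)) ⟨
    ∂ A * G ^ e + A * ∂ (G ^ e)                 ≈⟨ leibniz′ A (G ^ e) ⟨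
    ∂ (A * G ^ e)                               ≡⟨ ≡.cong ∂ (≡.sym (⟦summand⟧ α e g)) ⟩
    ∂ (⟦_⟧s F (summand α e g))                  ∎
    where
    e = suc N
    A = embedY F α
    G = ⟦_⟧g F g
    û = constant u
    σ₁ = summand (∂YPoly α) e g
    σ₂ = summand (scaleYPoly (𝔽.- (u 𝔽.* Δ𝔽.moment N e)) α) e g
    σⱼ : ℕ → Summand F n
    σⱼ j = summand (scaleYPoly (u 𝔽.* (Δ𝔽.sign j 𝔽.* Δ𝔽.fromℕ (N C j))) α) e (jg+∂g g j)
    ⟦σ₁⟧ : ⟦_⟧s F σ₁ ≡ ∂ A * G ^ e
    ⟦σ₁⟧ = ≡.trans (⟦summand⟧ (∂YPoly α) e g) (≡.cong (_* G ^ e) (embedY-∂ α))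
    ⟦σ₂⟧ : ⟦_⟧s F σ₂ ≈ ((- (û * moment N e)) * A) * G ^ e
    ⟦σ₂⟧ = trans (reflexive (⟦summand⟧ _ e g)) (*-congʳ (trans (embedY-scale≈constant* _ α)
             (*-congʳ (trans (-‿homo _) (-‿cong (trans (*-homo u _) (*-congˡ (moment-homo N e))))))))
    ⟦σⱼ⟧ : ∀ j → ⟦_⟧s F (σⱼ j) ≈ ((û * (sign j * fromℕ (N C j))) * A) * (fromℕ j * G + ∂ G) ^ e
    ⟦σⱼ⟧ j = trans (reflexive (⟦summand⟧ _ e (jg+∂g g j))) (*-cong
      (trans (embedY-scale≈constant* _ α) (*-congʳ (trans (*-homo u _)
        (*-congˡ (trans (*-homo _ _) (*-cong (sign-homo j) (fromℕ-homo (N C j))))))))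
      (^-congˡ e (⟦jg+∂g⟧≈ g j)))
    û*s≈1 : û * signedFactorial N ≈ 1#
    û*s≈1 = trans (*-congˡ (sym (signedFactorial-homo N))) (trans (sym (*-homo u _)) (trans (⟦⟧-cong u*s≈1) 1#-homo))

  ⟦∂constantCircuit⟧ : ∀ α Γ e g → embedY F Γ ≈ ⟦_⟧g F g ^ e →
    ⟦_⟧ F (∂constantCircuit α Γ g) ≈ ∂ (⟦_⟧s F (summand α e g))
  ⟦∂constantCircuit⟧ α Γ e g Γ≈G^e = begin
    ⟦_⟧ F (∂constantCircuit α Γ g)                     ≡⟨ ⟦∷⟧ σ [] ⟩
    ⟦_⟧s F σ + 0#                                      ≈⟨ +-identityʳ _ ⟩
    ⟦_⟧s F σ                                           ≡⟨ ⟦summand⟧ (∂YPoly (α *YPoly Γ)) 0 g ⟩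
    embedY F (∂YPoly (α *YPoly Γ)) * 1#                ≈⟨ *-identityʳ _ ⟩
    embedY F (∂YPoly (α *YPoly Γ))
      ≡⟨ ≡.trans (embedY-∂ (α *YPoly Γ)) (≡.cong ∂ (≡.trans (embedY-* α Γ) (≡.sym (*′≡*ₚ _ _)))) ⟩
    ∂ (embedY F α * embedY F Γ)                        ≈⟨ ∂-cong′ (*-congˡ Γ≈G^e) ⟩
    ∂ (embedY F α * ⟦_⟧g F g ^ e)                      ≡⟨ ≡.cong ∂ (≡.sym (⟦summand⟧ α e g)) ⟩
    ∂ (⟦_⟧s F (summand α e g))                         ∎
    where
    σ = summand (∂YPoly (α *YPoly Γ)) 0 g

  ⟦constantPart^⟧ : ∀ g e → maxDegree g ≡ 0 → embedY F (constantPart g ^YPoly e) ≈ ⟦_⟧g F g ^ e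
  ⟦constantPart^⟧ g e deg = reflexive (≡.trans (embedY-^ _ e)
    (≡.trans (≡.cong (λ p → _^^_ F p e) (≡.sym (⟦⟧g-degree0 g (allFin n) deg))) (^^≡^ (⟦_⟧g F g) e)))

module CharacteristicZero {c ℓ} (F : Field c ℓ) (char0 : CharZero F) where
  open Field F
  open FiniteDifference commutativeRing using (fromℕ; signedFactorial)
  open import Algebra.Properties.Ring ring using (-‿involutive; -0#≈0#)
  open import Relation.Binary.Reasoning.Setoid setoid

  fromℕ≡natMul : ∀ k → fromℕ k ≡ natMul F k 1#
  fromℕ≡natMul zero    = ≡.refl
  fromℕ≡natMul (suc k) = ≡.cong (1# +_) (fromℕ≡natMul k)

  fromℕ-suc≉0 : ∀ k → ¬ (fromℕ (suc k) ≈ 0#)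
  fromℕ-suc≉0 k k+1≈0 with char0 (suc k) (trans (reflexive (≡.sym (fromℕ≡natMul (suc k)))) k+1≈0)
  ... | ()

  x≉0∧y≉0⇒x*y≉0 : ∀ {x y} → ¬ (x ≈ 0#) → ¬ (y ≈ 0#) → ¬ (x * y ≈ 0#)
  x≉0∧y≉0⇒x*y≉0 {x} {y} x≉0 y≉0 x*y≈0 with inverse x x≉0
  ... | x⁻¹ , x*x⁻¹≈1 = y≉0 (begin
    y               ≈⟨ *-identityˡ y ⟨
    1# * y          ≈⟨ *-congʳ (trans (sym x*x⁻¹≈1) (*-comm x x⁻¹)) ⟩
    (x⁻¹ * x) * y   ≈⟨ *-assoc _ _ _ ⟩
    x⁻¹ * (x * y)   ≈⟨ *-congˡ x*y≈0 ⟩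
    x⁻¹ * 0#        ≈⟨ zeroʳ _ ⟩
    0#              ∎)

  x≉0⇒-x≉0 : ∀ {x} → ¬ (x ≈ 0#) → ¬ (- x ≈ 0#)
  x≉0⇒-x≉0 {x} x≉0 -x≈0 = x≉0 (trans (sym (-‿involutive x)) (trans (-‿cong -x≈0) -0#≈0#))

  signedFactorial≉0 : ∀ N → ¬ (signedFactorial N ≈ 0#)
  signedFactorial≉0 zero    = 1≉0
  signedFactorial≉0 (suc N) = x≉0⇒-x≉0 (x≉0∧y≉0⇒x*y≉0 (fromℕ-suc≉0 N) (signedFactorial≉0 N))

  signedFactorial-invertible : ∀ N → Σ Carrier λ u → u * signedFactorial N ≈ 1#
  signedFactorial-invertible N with inverse (signedFactorial N) (signedFactorial≉0 N)
  ... | u , s*u≈1 = u , trans (*-comm u _) s*u≈1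

module ∂Circuit {c ℓ} (F : Field c ℓ) (char0 : CharZero F) (n : ℕ) where
  open DerivativeCircuit F n
  open CharacteristicZero F char0 using (signedFactorial-invertible)

  -- If G does not involve x, the exponent is not bounded by the degree.
  ∂summand : Summand F n → Circuit F n
  ∂summand (summand α zero    g) = ∂constantCircuit α (constantPart g ^YPoly 0) g
  ∂summand (summand α (suc N) g) with maxDegree g ℕ.≟ 0
  ... | yes _ = ∂constantCircuit α (constantPart g ^YPoly suc N) g
  ... | no  _ = ∂powerCircuit α N g (proj₁ (signedFactorial-invertible N))

  ∂circuit : Circuit F n → Circuit F n
  ∂circuit = concatMap ∂summand

  module _ where
    open PolynomialRing F n using (∂; ≈′⇒≈ₚ; +′≡+ₚ; polynomialRing)
    open CircuitSemantics F n
    open CommutativeRing polynomialRing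
    open import Relation.Binary.Reasoning.Setoid setoid

    ⟦∂summand⟧ : ∀ σ → ⟦_⟧ F (∂summand σ) ≈ ∂ (⟦_⟧s F σ)
    ⟦∂summand⟧ (summand α zero    g) = ⟦∂constantCircuit⟧ α _ 0 g refl
    ⟦∂summand⟧ (summand α (suc N) g) with maxDegree g ℕ.≟ 0
    ... | yes deg≡0 = ⟦∂constantCircuit⟧ α _ (suc N) g (⟦constantPart^⟧ g (suc N) deg≡0)
    ... | no  _     = ⟦∂powerCircuit⟧ α N g _ (proj₂ (signedFactorial-invertible N))

    ⟦∂circuit⟧ : ∀ σs → ⟦_⟧ F (∂circuit σs) ≈ ∂ (⟦_⟧ F σs)
    ⟦∂circuit⟧ []       = refl
    ⟦∂circuit⟧ (σ ∷ σs) = begin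
      ⟦_⟧ F (∂summand σ ++ ∂circuit σs)        ≈⟨ ⟦++⟧ (∂summand σ) (∂circuit σs) ⟩
      ⟦_⟧ F (∂summand σ) + ⟦_⟧ F (∂circuit σs) ≈⟨ +-cong (⟦∂summand⟧ σ) (⟦∂circuit⟧ σs) ⟩
      ∂ (⟦_⟧s F σ) + ∂ (⟦_⟧ F σs)              ≡⟨ +′≡+ₚ _ _ ⟩
      ∂ (⟦_⟧s F σ) ++ ∂ (⟦_⟧ F σs)             ≡⟨ ListP.map-++ _ (⟦_⟧s F σ) (⟦_⟧ F σs) ⟨
      ∂ (⟦_⟧ F (σ ∷ σs))                       ∎

    ∂circuit-correct : ∀ σs → _≋_ F (⟦_⟧ F (∂circuit σs)) (∂y F (⟦_⟧ F σs))
    ∂circuit-correct σs = ≈′⇒≈ₚ (⟦∂circuit⟧ σs)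

  module _ where
    open ℕP.≤-Reasoning

    private
      m≤4*d*m : ∀ d m → 1 ≤ d → m ≤ 4 ℕ.* d ℕ.* m
      m≤4*d*m (suc d) m _ = ℕP.m≤n*m m (4 ℕ.* suc d)

      2*[1+e]≤4*e : ∀ e → 1 ≤ e → 2 ℕ.* suc e ≤ 4 ℕ.* e
      2*[1+e]≤4*e (suc e) _ = begin
        2 ℕ.* suc (suc e) ≡⟨ 2*[2+e]≡4+2*e e ⟩
        4 ℕ.+ 2 ℕ.* e     ≤⟨ ℕP.+-monoʳ-≤ 4 (ℕP.*-monoˡ-≤ e (s≤s (s≤s (z≤n {2})))) ⟩
        4 ℕ.+ 4 ℕ.* e     ≡⟨ ℕP.*-suc 4 e ⟨
        4 ℕ.* suc e       ∎
        where
        2*[2+e]≡4+2*e : ∀ e → 2 ℕ.* suc (suc e) ≡ 4 ℕ.+ 2 ℕ.* e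
        2*[2+e]≡4+2*e = solve-∀

    size-∂summand : ∀ d σ → 1 ≤ d → degS F σ ≤ d → size F (∂summand σ) ≤ 4 ℕ.* d ℕ.* sizeS F σ
    size-∂summand d (summand α zero g) 1≤d _ = ℕP.≤-trans (size-∂constantCircuit α (constantPart g ^YPoly 0) 0 g) (m≤4*d*m d _ 1≤d)
    size-∂summand d (summand α (suc N) g) 1≤d deg with maxDegree g ℕ.≟ 0
    ... | yes _   = ℕP.≤-trans (size-∂constantCircuit α (constantPart g ^YPoly suc N) (suc N) g) (m≤4*d*m d _ 1≤d)
    ... | no D≢0 = begin
      size F (∂powerCircuit α N g _)      ≤⟨ size-∂powerCircuit α N g _ ⟩
      2 ℕ.* suc (suc N) ℕ.* Z             ≤⟨ ℕP.*-monoˡ-≤ Z (ℕP.≤-trans (2*[1+e]≤4*e (suc N) (s≤s z≤n)) (ℕP.*-monoʳ-≤ 4 e≤d)) ⟩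
      4 ℕ.* d ℕ.* Z                       ∎
      where
      Z = sizeS F (summand α (suc N) g)
      e≤d : suc N ≤ d
      e≤d = ℕP.≤-trans (ℕP.m≤m*n (suc N) (maxDegree g) ⦃ ℕ.≢-nonZero D≢0 ⦄) deg

    size-∂circuit : ∀ d σs → 1 ≤ d → degree F σs ≤ d → size F (∂circuit σs) ≤ 4 ℕ.* d ℕ.* size F σs
    size-∂circuit d []       _   _   = z≤n
    size-∂circuit d (σ ∷ σs) 1≤d deg = begin
      size F (∂summand σ ++ ∂circuit σs)                        ≡⟨ size-++ (∂summand σ) (∂circuit σs) ⟩
      size F (∂summand σ) ℕ.+ size F (∂circuit σs)
        ≤⟨ ℕP.+-mono-≤ (size-∂summand d σ 1≤d (ℕP.≤-trans (ℕP.m≤m⊔n _ _) deg))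
                       (size-∂circuit d σs 1≤d (ℕP.≤-trans (ℕP.m≤n⊔m (degS F σ) _) deg)) ⟩
      4 ℕ.* d ℕ.* sizeS F σ ℕ.+ 4 ℕ.* d ℕ.* size F σs           ≡⟨ ℕP.*-distribˡ-+ (4 ℕ.* d) (sizeS F σ) (size F σs) ⟨
      4 ℕ.* d ℕ.* size F (σ ∷ σs)                               ∎

-- Imported only here: above, _*_ and _^_ would clash with the ring operations.
open import Data.Nat using (_*_; _^_)

4*d*m≤4*s*d^2 : ∀ {m s} d → 1 ≤ d → m ≤ s → 4 * d * m ≤ 4 * s * d ^ 2
4*d*m≤4*s*d^2 {m} {s} d 1≤d m≤s = begin
  4 * d * m       ≤⟨ ℕP.*-monoʳ-≤ (4 * d) m≤s ⟩
  4 * d * s       ≤⟨ ℕP.m≤m*n (4 * d * s) d ⦃ ℕ.>-nonZero 1≤d ⦄ ⟩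
  4 * d * s * d   ≡⟨ 4ds*d≡4s*d^2 d s ⟩
  4 * s * d ^ 2   ∎
  where
  open ℕP.≤-Reasoning
  4ds*d≡4s*d^2 : ∀ d s → 4 * d * s * d ≡ 4 * s * (d * (d * 1))
  4ds*d≡4s*d^2 = solve-∀

lemma3p5 : ∀ {c ℓ : Level} → Σ ℕ λ K →
    (F : Field c ℓ) → CharZero F →
    (n s d : ℕ) → 1 ≤ d → (C : Circuit F n) →
    size F C ≤ s → degree F C ≤ d →
    ∃ λ (C' : Circuit F n) →
      (size F C' ≤ K * s * d ^ 2) × (_≋_ F (⟦_⟧ F C') (∂y F (⟦_⟧ F C)))
lemma3p5 = 4 , λ F char0 n s d 1≤d C size≤s degree≤d →
  let open ∂Circuit F char0 n in
  ∂circuit C , ℕP.≤-trans (size-∂circuit d C 1≤d degree≤d) (4*d*m≤4*s*d^2 d 1≤d size≤s) , ∂circuit-correct C
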